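{- Let $k\ge 2$, let $p_1,\dots,p_k$ be primes and $m_1,\dots,m_k\ge 1$ integers, and let $R=\mathbb{Z}_{p_1^{m_1}}\times\cdots\times\mathbb{Z}_{p_k^{m_k}}$. For each $i$ and $0\le j\le m_i$ let $X_i^0=\{0\}$ and, for $1\le j\le m_i$, $X_i^j=\{a\in\mathbb{Z}_{p_i^{m_i}}:\gcd(a,p_i^{m_i})=p_i^{j-1}\}$ (so $X_i^1$ is the unit group). Let $J$ be the set of tuples $\mathbf{j}=(j_1,\dots,j_k)$ with $0\le j_i\le m_i$, excluding the tuple with all $j_i=0$ and the tuple with all $j_i=1$; the classes $C_{\mathbf j}=X_1^{j_1}\times\cdots\times X_k^{j_k}$, $\mathbf j\in J$, partition the vertex set of $\Gamma'(R)$. Put $N(\mathbf j)=\prod_{i:\, j_i\ge 1}(p_i^{m_i-j_i+1}-p_i^{m_i-j_i})$. For $\mathbf j,\mathbf l\in J$ write $\mathbf j\preceq\mathbf l$ if for every $i$ either $j_i=0$, or $l_i\ge1$ and $j_i\ge l_i$. Call distinct $\mathbf j,\mathbf l$ adjacent if neither $\mathbf j\preceq\mathbf l$ nor $\mathbf l\preceq\mathbf j$. Let $S$ be the set of unordered pairs $\{\mathbf j,\mathbf l\}$ for which there is $r\in[k]$ with $j_r\ge 2$, $l_r\ge 2$, $j_r\ge l_r$, and $j_i=0$, $l_i=1$ for all $i\ne r$. Then \[ W(\Gamma'(R)) = 2\sum_{\mathbf j\in J}\binom{N(\mathbf j)}{2} + \sum_{\{\mathbf j,\mathbf l\}\ \text{adjacent}}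 N(\mathbf j)N(\mathbf l) + 2\sum_{\substack{\{\mathbf j,\mathbf l\}\ \text{non-adjacent}\\ \{\mathbf j,\mathbf l\}\notin S}} N(\mathbf j)N(\mathbf l) + 3\sum_{\{\mathbf j,\mathbf l\}\in S} N(\mathbf j)N(\mathbf l), \] where the last three sums run over unordered pairs of distinct elements of $J$.
   Context: The cozero-divisor graph $\Gamma'(R)$ of a ring $R$ with unity is the simple undirected graph whose vertices are the non-zero non-unit elements of $R$, with distinct vertices $x,y$ adjacent iff $x\notin Ry$ and $y\notin Rx$. The Wiener index of a connected graph is the sum of the shortest-path distances over all unordered pairs of distinct vertices. In the paper's notation, "$(x,y)\in S_r$" means $x$ has a nonzero zero-divisor $x_r$ in coordinate $r$ and $0$ elsewhere, $y$ has a nonzero zero-divisor $y_r$ with $(x_r)\subseteq(y_r)$ in coordinate $r$ and units elsewhere; this is encoded by $S$ above. -}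

module Defs where

open import Data.Nat using (ℕ; zero; suc; _+_; _*_; _∸_; _^_; _≤_; _≟_)
open import Data.Nat.DivMod using (_mod_)
open import Data.Nat.Combinatorics using (_C_)
open import Data.Fin using (Fin; toℕ) renaming (zero to fzero; suc to fsuc)
import Data.Fin as F
open import Data.Fin.Properties using (all?; any?)
open import Data.List using (List; []; _∷_; [_]; map; concatMap; allFin; filter)
open import Data.Nat.ListAction using (sum)
open import Data.List.Relation.Unary.AllPairs using (AllPairs)
open import Data.Product using (Σ; ∃; _×_; _,_; proj₁; proj₂)
open import Data.Sum using (_⊎_; inj₁; inj₂)
open import Data.Empty using (⊥)
open import Relation.Nullary using (¬_; Dec; yes; no; does)
open import Relation.Nullary.Decidable using (_×-dec_; _⊎-dec_; ¬?)
open import Relation.Binary.PropositionalEquality using (_≡_; _≢_)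
open import Data.Bool using (if_then_else_)

Tuple : (k : ℕ) → (Fin k → ℕ) → Set
Tuple k n = (i : Fin k) → Fin (n i)

cons : ∀ {k} {n : Fin (suc k) → ℕ} → Fin (n fzero) →
       ((i : Fin k) → Fin (n (fsuc i))) → Tuple (suc k) n
cons a f fzero    = a
cons a f (fsuc i) = f i

allTuples : (k : ℕ) (n : Fin k → ℕ) → List (Tuple k n)
allTuples zero    n = [ (λ ()) ]
allTuples (suc k) n =
  concatMap (λ a → map (λ f → cons {k} {n} a f) (allTuples k (λ i → n (fsuc i))))
            (allFin (n fzero))

mulMod : (n : ℕ) → Fin n → Fin n → Fin n
mulMod zero    ()
mulMod (suc n) a b = (toℕ a * toℕ b) mod (suc n)

IsOne : (n : ℕ) → Fin n → Set
IsOne zero    ()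
IsOne (suc n) a = a ≡ (1 mod (suc n))

isOne? : (n : ℕ) (a : Fin n) → Dec (IsOne n a)
isOne? zero    ()
isOne? (suc n) a = a F.≟ (1 mod (suc n))

module ProductRing (k : ℕ) (n : Fin k → ℕ) where

  R : Set
  R = Tuple k n

  _·_ : R → R → R
  (x · y) i = mulMod (n i) (x i) (y i)

  _≈_ : R → R → Set
  x ≈ y = ∀ i → x i ≡ y i

  IsZero : R → Set
  IsZero x = ∀ i → toℕ (x i) ≡ 0

  IsUnit : R → Set
  IsUnit x = Σ R λ u → ∀ i → IsOne (n i) ((x · u) i)

  _∈R_ : R → R → Set
  x ∈R y = Σ R λ r → x ≈ (r · y)

  IsVertex : R → Set
  IsVertex x = ¬ IsZero x × ¬ IsUnit x

  Adj : R → R → Set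
  Adj x y = ¬ (x ∈R y) × ¬ (y ∈R x)

  isZero? : (x : R) → Dec (IsZero x)
  isZero? x = all? (λ i → toℕ (x i) ≟ 0)

  isUnit? : (x : R) → Dec (IsUnit x)
  isUnit? x with all? (λ i → any? (λ a → isOne? (n i) (mulMod (n i) (x i) a)))
  ... | yes f = yes ((λ i → proj₁ (f i)) , (λ i → proj₂ (f i)))
  ... | no ¬f = no (λ { (u , h) → ¬f (λ i → u i , h i) })

  isVertex? : (x : R) → Dec (IsVertex x)
  isVertex? x = ¬? (isZero? x) ×-dec ¬? (isUnit? x)

  vertices : List R
  vertices = filter isVertex? (allTuples k n)

  data Walk : R → R → ℕ → Set where
    here : ∀ {x y} → x ≈ y → Walk x y 0
    step : ∀ {x z y l} → IsVertex z → Adj x z → Walk z y l → Walk x y (suc l)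

  IsDistance : R → R → ℕ → Set
  IsDistance x y d = Walk x y d × (∀ l → Walk x y l → d ≤ l)

-- sum over unordered pairs of distinct entries of a list (positions i < j)
pairSum : ∀ {A : Set} → (A → A → ℕ) → List A → ℕ
pairSum f []       = 0
pairSum f (x ∷ xs) = sum (map (f x) xs) + pairSum f xs

prodFin : (k : ℕ) → (Fin k → ℕ) → ℕ
prodFin zero    f = 1
prodFin (suc k) f = f fzero * prodFin k (λ i → f (fsuc i))

ind : ∀ {P : Set} → Dec P → ℕ → ℕ
ind d v = if does d then v else 0

-- Wiener index of Γ'(R):  W(Γ'(R)) = w  means Γ'(R) is connected (all
-- distances exist) and the sum of distances over unordered pairs of
-- distinct vertices equals w.

WienerIndexIs : (k : ℕ) (n : Fin k → ℕ) → ℕ → Set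
WienerIndexIs k n w =
  Σ (R → R → ℕ) λ dist →
    AllPairs (λ x y → IsDistance x y (dist x y)) vertices × pairSum dist vertices ≡ w
  where open ProductRing k n

module Classes (k : ℕ) (p m : Fin k → ℕ) where

  Idx : Set
  Idx = Tuple k (λ i → suc (m i))

  AllZero : Idx → Set
  AllZero j = ∀ i → toℕ (j i) ≡ 0

  AllOne : Idx → Set
  AllOne j = ∀ i → toℕ (j i) ≡ 1

  InJ : Idx → Set
  InJ j = ¬ AllZero j × ¬ AllOne j

  inJ? : (j : Idx) → Dec (InJ j)
  inJ? j = ¬? (all? (λ i → toℕ (j i) ≟ 0)) ×-dec ¬? (all? (λ i → toℕ (j i) ≟ 1))

  J : List Idx
  J = filter inJ? (allTuples k (λ i → suc (m i)))

  factor : ℕ → ℕ → ℕ → ℕ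
  factor q e zero    = 1
  factor q e (suc t) = q ^ (e ∸ suc t + 1) ∸ q ^ (e ∸ suc t)

  N : Idx → ℕ
  N j = prodFin k (λ i → factor (p i) (m i) (toℕ (j i)))

  _≼_ : Idx → Idx → Set
  j ≼ l = ∀ i → toℕ (j i) ≡ 0 ⊎ (1 ≤ toℕ (l i) × toℕ (l i) ≤ toℕ (j i))

  ≼? : (j l : Idx) → Dec (j ≼ l)
  ≼? j l = all? (λ i → (toℕ (j i) ≟ 0) ⊎-dec ((1 Data.Nat.≤? toℕ (l i)) ×-dec (toℕ (l i) Data.Nat.≤? toℕ (j i))))
    where import Data.Nat

  -- adjacency of classes (distinctness is guaranteed by summing over
  -- pairs of distinct list positions)
  ClassAdj : Idx → Idx → Set
  ClassAdj j l = ¬ (j ≼ l) × ¬ (l ≼ j)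

  classAdj? : (j l : Idx) → Dec (ClassAdj j l)
  classAdj? j l = ¬? (≼? j l) ×-dec ¬? (≼? l j)

  -- ordered version of membership in S (witness r)
  S₀ : Idx → Idx → Set
  S₀ j l = ∃ λ (r : Fin k) →
    (2 ≤ toℕ (j r)) × (2 ≤ toℕ (l r)) × (toℕ (l r) ≤ toℕ (j r)) ×
    (∀ i → i ≢ r → toℕ (j i) ≡ 0 × toℕ (l i) ≡ 1)

  S₀? : (j l : Idx) → Dec (S₀ j l)
  S₀? j l = any? (λ r →
    (2 Data.Nat.≤? toℕ (j r)) ×-dec (2 Data.Nat.≤? toℕ (l r)) ×-dec
    (toℕ (l r) Data.Nat.≤? toℕ (j r)) ×-dec
    all? (λ i → dimp i r))
    where
    import Data.Nat
    dimp : (i r : Fin k) → Dec (i ≢ r → toℕ (j i) ≡ 0 × toℕ (l i) ≡ 1)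
    dimp i r with i F.≟ r
    ... | yes i≡r = yes (λ i≢r → Data.Empty.⊥-elim (i≢r i≡r))
      where import Data.Empty
    ... | no i≢r with (toℕ (j i) ≟ 0) ×-dec (toℕ (l i) ≟ 1)
    ...   | yes q = yes (λ _ → q)
    ...   | no ¬q = no (λ f → ¬q (f i≢r))

  InS : Idx → Idx → Set
  InS j l = S₀ j l ⊎ S₀ l j

  inS? : (j l : Idx) → Dec (InS j l)
  inS? j l = S₀? j l ⊎-dec S₀? l j

  RHS : ℕ
  RHS = 2 * sum (map (λ j → N j C 2) J)
      + pairSum (λ j l → ind (classAdj? j l) (N j * N l)) J
      + 2 * pairSum (λ j l → ind (¬? (classAdj? j l) ×-dec ¬? (inS? j l)) (N j * N l)) J
      + 3 * pairSum (λ j l → ind (inS? j l) (N j * N l)) J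

{-# OPTIONS --safe #-}
-- Sort the elements of R by their class: the tuple j with x_i ∈ X_i^{j_i}.  In ℤ_{p^m}
-- one has a ∈ ℤ b iff v_p(b) ≤ v_p(a), so x ∈ R y holds iff class x ≼ class y; hence
-- adjacency in Γ'(R) is adjacency of classes, and the vertices are the elements whose
-- class lies in J.  For non-adjacent classes outside S some 1 - e_a is a common
-- neighbour; a pair in S has no common neighbour but is joined by the path through
-- 1 - e_r and e_r.  So the distance between distinct vertices is 1, 2 or 3 according to
-- their classes alone, and since C_j has N(j) elements, summing over ordered pairs of
-- vertices and removing the diagonal gives the formula, the pairs inside one class
-- (at distance 2) producing the binomial term.
module Submission where

open import Defs
open import Level using (0ℓ)
open import Algebra.Properties.CommutativeSemigroup using (interchange)
open import Data.Bool using (true; false)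
open import Data.Empty using (⊥-elim)
open import Data.Fin using (Fin; toℕ; fromℕ<) renaming (zero to fzero; suc to fsuc)
import Data.Fin as F
import Data.Fin.Properties as FP
open import Data.List using (List; []; _∷_; _++_; map; filter; allFin; concatMap; cartesianProductWith)
open import Data.List.Properties using (map-cong; map-tabulate; map-++; map-∘)
open import Data.List.Relation.Unary.All using (All; []; _∷_)
import Data.List.Relation.Unary.All as All
open import Data.List.Relation.Unary.All.Properties using (all-filter)
open import Data.List.Relation.Unary.AllPairs using (AllPairs; []; _∷_)
import Data.List.Relation.Unary.AllPairs as AllPairs
open import Data.List.Relation.Unary.Unique.Setoid using (Unique)
open import Data.List.Relation.Unary.Unique.Setoid.Properties using (cartesianProductWith⁺; filter⁺)
open import Data.List.Relation.Unary.Unique.Propositional.Properties using (allFin⁺)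
open import Data.Nat
open import Data.Nat.Properties
open import Data.Nat.Combinatorics using (_C_; nC1≡n; nCk+nC[k+1]≡[n+1]C[k+1])
open import Data.Nat.Coprimality using (Coprime; coprime-Bézout; coprime-divisor)
open import Data.Nat.DivMod
open import Data.Nat.Divisibility
import Data.Nat.GCD as GCD
open import Data.Nat.ListAction using (sum)
open import Data.Nat.ListAction.Properties using (sum-++)
open import Data.Nat.Primality using (Prime; prime⇒nonZero; prime⇒nonTrivial; prime⇒irreducible)
open import Data.Nat.Solver using (module +-*-Solver)
open import Data.Product using (Σ; ∃; ∃-syntax; _×_; _,_; proj₁; proj₂)
open import Data.Sum using (_⊎_; inj₁; inj₂; [_,_]′)
open import Function using (_∘_; id; case_of_)
open import Relation.Binary.Bundles using (Setoid)
open import Relation.Binary.PropositionalEquality hiding (J)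
open import Relation.Nullary using (¬_; Dec; yes; no; does)
open import Relation.Nullary.Decidable using (_×-dec_; _⊎-dec_; ¬?; decidable-stable)
open import Relation.Unary using (Pred; Decidable)
open +-*-Solver

+-interchange : ∀ w x y z → (w + x) + (y + z) ≡ (w + y) + (x + z)
+-interchange = interchange +-commutativeSemigroup

ind-yes : ∀ {P : Set} (d : Dec P) {x} → P → ind d x ≡ x
ind-yes (yes _) _ = refl
ind-yes (no ¬p) p = ⊥-elim (¬p p)

ind-no : ∀ {P : Set} (d : Dec P) {x} → ¬ P → ind d x ≡ 0
ind-no (yes p) ¬p = ⊥-elim (¬p p)
ind-no (no _) _ = refl

ind-⇔ : ∀ {P Q : Set} → (P → Q) → (Q → P) → (d : Dec P) (e : Dec Q) {x : ℕ} → ind d x ≡ ind e x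
ind-⇔ _ _ (yes _) (yes _) = refl
ind-⇔ f _ (yes p) (no ¬q) = ⊥-elim (¬q (f p))
ind-⇔ _ g (no ¬p) (yes q) = ⊥-elim (¬p (g q))
ind-⇔ _ _ (no _)  (no _)  = refl

ind≡ind1* : ∀ {P : Set} (d : Dec P) x → ind d x ≡ ind d 1 * x
ind≡ind1* (yes _) x = sym (+-identityʳ x)
ind≡ind1* (no _)  x = refl

*-ind : ∀ {P : Set} (d : Dec P) a b → a * ind d b ≡ ind d (a * b)
*-ind (yes _) a b = refl
*-ind (no _)  a b = *-zeroʳ a

module _ {A : Set} where

  sum-map-cong : ∀ {f g : A → ℕ} → f ≗ g → ∀ xs → sum (map f xs) ≡ sum (map g xs)
  sum-map-cong f≗g xs = cong sum (map-cong f≗g xs)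

  sum-map-0 : ∀ {f : A → ℕ} → (∀ x → f x ≡ 0) → ∀ xs → sum (map f xs) ≡ 0
  sum-map-0 f≡0 []       = refl
  sum-map-0 f≡0 (x ∷ xs) = cong₂ _+_ (f≡0 x) (sum-map-0 f≡0 xs)

  sum-map-+ : ∀ (f g : A → ℕ) xs →
              sum (map (λ x → f x + g x) xs) ≡ sum (map f xs) + sum (map g xs)
  sum-map-+ f g []       = refl
  sum-map-+ f g (x ∷ xs) =
    trans (cong (f x + g x +_) (sum-map-+ f g xs)) (+-interchange (f x) (g x) _ _)

  sum-map-*ˡ : ∀ c (f : A → ℕ) xs → sum (map (λ x → c * f x) xs) ≡ c * sum (map f xs)
  sum-map-*ˡ c f []       = sym (*-zeroʳ c)
  sum-map-*ˡ c f (x ∷ xs) =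
    trans (cong (c * f x +_) (sum-map-*ˡ c f xs)) (sym (*-distribˡ-+ c (f x) _))

  sum-map-*ʳ : ∀ c (f : A → ℕ) xs → sum (map (λ x → f x * c) xs) ≡ sum (map f xs) * c
  sum-map-*ʳ c f xs =
    trans (sum-map-cong (λ x → *-comm (f x) c) xs) (trans (sum-map-*ˡ c f xs) (*-comm c _))

  sum-map-filter : ∀ {P : Pred A _} (P? : Decidable P) (f : A → ℕ) xs →
                   sum (map f (filter P? xs)) ≡ sum (map (λ x → ind (P? x) (f x)) xs)
  sum-map-filter P? f []       = refl
  sum-map-filter P? f (x ∷ xs) with does (P? x)
  ... | true  = cong (f x +_) (sum-map-filter P? f xs)
  ... | false = sum-map-filter P? f xs

  pairSum-cong : ∀ {f g : A → A → ℕ} → (∀ x y → f x y ≡ g x y) → ∀ xs → pairSum f xs ≡ pairSum g xs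
  pairSum-cong f≡g []       = refl
  pairSum-cong f≡g (x ∷ xs) = cong₂ _+_ (sum-map-cong (f≡g x) xs) (pairSum-cong f≡g xs)

  pairSum-+ : ∀ (f g : A → A → ℕ) xs →
              pairSum (λ x y → f x y + g x y) xs ≡ pairSum f xs + pairSum g xs
  pairSum-+ f g []       = refl
  pairSum-+ f g (x ∷ xs) =
    trans (cong₂ _+_ (sum-map-+ (f x) (g x) xs) (pairSum-+ f g xs))
          (+-interchange (sum (map (f x) xs)) (sum (map (g x) xs)) (pairSum f xs) (pairSum g xs))

  pairSum-*ˡ : ∀ c (f : A → A → ℕ) xs → pairSum (λ x y → c * f x y) xs ≡ c * pairSum f xs
  pairSum-*ˡ c f []       = sym (*-zeroʳ c)
  pairSum-*ˡ c f (x ∷ xs) =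
    trans (cong₂ _+_ (sum-map-*ˡ c (f x) xs) (pairSum-*ˡ c f xs)) (sym (*-distribˡ-+ c _ _))

  pairSum-symmetric : ∀ (f : A → A → ℕ) → (∀ x y → f x y ≡ f y x) → ∀ xs →
    2 * pairSum f xs + sum (map (λ x → f x x) xs) ≡ sum (map (λ x → sum (map (f x) xs)) xs)
  pairSum-symmetric f sym-f []       = refl
  pairSum-symmetric f sym-f (x ∷ xs) = sym (begin
    f x x + S + sum (map (λ y → f y x + sum (map (f y) xs)) xs)
      ≡⟨ cong (f x x + S +_) (sum-map-+ (λ y → f y x) (λ y → sum (map (f y) xs)) xs) ⟩
    f x x + S + (sum (map (λ y → f y x) xs) + T)
      ≡⟨ cong (λ z → f x x + S + (z + T)) (sum-map-cong (λ y → sym-f y x) xs) ⟩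
    f x x + S + (S + T)
      ≡⟨ cong (λ z → f x x + S + (S + z)) (sym (pairSum-symmetric f sym-f xs)) ⟩
    f x x + S + (S + (2 * P + D))
      ≡⟨ solve 4 (λ a S P D → a :+ S :+ (S :+ (con 2 :* P :+ D)) := con 2 :* (S :+ P) :+ (a :+ D))
               refl (f x x) S P D ⟩
    2 * (S + P) + (f x x + D) ∎)
    where
    open ≡-Reasoning
    S = sum (map (f x) xs)
    P = pairSum f xs
    D = sum (map (λ y → f y y) xs)
    T = sum (map (λ y → sum (map (f y) xs)) xs)

module _ {A B : Set} where

  sum-swap : ∀ (f : A → B → ℕ) xs ys →
    sum (map (λ x → sum (map (f x) ys)) xs) ≡ sum (map (λ y → sum (map (λ x → f x y) xs)) ys)
  sum-swap f []       ys = sym (sum-map-0 (λ _ → refl) ys)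
  sum-swap f (x ∷ xs) ys = trans (cong (sum (map (f x) ys) +_) (sum-swap f xs ys))
    (sym (sum-map-+ (f x) (λ y → sum (map (λ x → f x y) xs)) ys))

  sum-map-map : ∀ (g : B → ℕ) (f : A → B) xs → sum (map g (map f xs)) ≡ sum (map (g ∘ f) xs)
  sum-map-map g f xs = cong sum (sym (map-∘ xs))

  sum-concatMap : ∀ (g : B → ℕ) (F : A → List B) xs →
    sum (map g (concatMap F xs)) ≡ sum (map (λ x → sum (map g (F x))) xs)
  sum-concatMap g F []       = refl
  sum-concatMap g F (x ∷ xs) = trans (cong sum (map-++ g (F x) (concatMap F xs)))
    (trans (sum-++ (map g (F x)) (map g (concatMap F xs)))
           (cong (sum (map g (F x)) +_) (sum-concatMap g F xs)))

sum-allFin-suc : ∀ n (h : Fin (suc n) → ℕ) →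
                 sum (map h (allFin (suc n))) ≡ h fzero + sum (map (h ∘ fsuc) (allFin n))
sum-allFin-suc n h =
  cong (λ hs → h fzero + sum hs) (trans (map-tabulate fsuc h) (sym (map-tabulate id (h ∘ fsuc))))

sum-allFin-select : ∀ n (c : Fin n) (h : Fin n → ℕ) →
                    sum (map (λ d → ind (c F.≟ d) (h d)) (allFin n)) ≡ h c
sum-allFin-select (suc n) fzero h = begin
  sum (map (λ d → ind (fzero F.≟ d) (h d)) (allFin (suc n))) ≡⟨ sum-allFin-suc n (λ d → ind (fzero F.≟ d) (h d)) ⟩
  ind (fzero {n} F.≟ fzero) (h fzero) + sum (map (λ d → ind (fzero F.≟ fsuc d) (h (fsuc d))) (allFin n))
    ≡⟨ cong₂ _+_ (ind-yes (fzero {n} F.≟ fzero) refl)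
                 (sum-map-0 (λ d → ind-no (fzero F.≟ fsuc d) {h (fsuc d)} (λ ())) (allFin n)) ⟩
  h fzero + 0 ≡⟨ +-identityʳ (h fzero) ⟩
  h fzero ∎
  where open ≡-Reasoning
sum-allFin-select (suc n) (fsuc c) h = begin
  sum (map (λ d → ind (fsuc c F.≟ d) (h d)) (allFin (suc n))) ≡⟨ sum-allFin-suc n (λ d → ind (fsuc c F.≟ d) (h d)) ⟩
  ind (fsuc c F.≟ fzero) (h fzero) + sum (map (λ d → ind (fsuc c F.≟ fsuc d) (h (fsuc d))) (allFin n))
    ≡⟨ cong₂ _+_ (ind-no (fsuc c F.≟ fzero) {h fzero} (λ ()))
                 (sum-map-cong (λ d → ind-⇔ FP.suc-injective (cong fsuc) (fsuc c F.≟ fsuc d) (c F.≟ d) {h (fsuc d)})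
                               (allFin n)) ⟩
  sum (map (λ d → ind (c F.≟ d) (h (fsuc d))) (allFin n)) ≡⟨ sum-allFin-select n c (h ∘ fsuc) ⟩
  h (fsuc c) ∎
  where open ≡-Reasoning

sumBelow : ℕ → (ℕ → ℕ) → ℕ
sumBelow zero    f = 0
sumBelow (suc n) f = f 0 + sumBelow n (f ∘ suc)

sum-allFin-toℕ : ∀ n (f : ℕ → ℕ) → sum (map (f ∘ toℕ) (allFin n)) ≡ sumBelow n f
sum-allFin-toℕ zero    f = refl
sum-allFin-toℕ (suc n) f = trans (sum-allFin-suc n (f ∘ toℕ)) (cong (f 0 +_) (sum-allFin-toℕ n (f ∘ suc)))

sumBelow-cong : ∀ n {f g : ℕ → ℕ} → (∀ a → a < n → f a ≡ g a) → sumBelow n f ≡ sumBelow n g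
sumBelow-cong zero    f≡g = refl
sumBelow-cong (suc n) f≡g = cong₂ _+_ (f≡g 0 z<s) (sumBelow-cong n (λ a a<n → f≡g (suc a) (s<s a<n)))

sumBelow-0 : ∀ n {f : ℕ → ℕ} → (∀ a → a < n → f a ≡ 0) → sumBelow n f ≡ 0
sumBelow-0 zero    f≡0 = refl
sumBelow-0 (suc n) f≡0 = cong₂ _+_ (f≡0 0 z<s) (sumBelow-0 n (λ a a<n → f≡0 (suc a) (s<s a<n)))

sumBelow-+ : ∀ a b f → sumBelow (a + b) f ≡ sumBelow a f + sumBelow b (λ x → f (a + x))
sumBelow-+ zero    b f = refl
sumBelow-+ (suc a) b f = trans (cong (f 0 +_) (sumBelow-+ a b (f ∘ suc))) (sym (+-assoc (f 0) _ _))

sumBelow-distrib : ∀ n f g → sumBelow n (λ a → f a + g a) ≡ sumBelow n f + sumBelow n g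
sumBelow-distrib zero    f g = refl
sumBelow-distrib (suc n) f g =
  trans (cong (f 0 + g 0 +_) (sumBelow-distrib n (f ∘ suc) (g ∘ suc))) (+-interchange (f 0) (g 0) _ _)

count-multiples : ∀ q d .{{_ : NonZero d}} → sumBelow (q * d) (λ a → ind (d ∣? a) 1) ≡ q
count-multiples zero    d           = refl
count-multiples (suc q) d@(suc d-1) = begin
  sumBelow (d + q * d) φ                            ≡⟨ sumBelow-+ d (q * d) φ ⟩
  sumBelow d φ + sumBelow (q * d) (λ x → φ (d + x)) ≡⟨ cong₂ _+_ first-block (sumBelow-cong (q * d) shift) ⟩
  1 + sumBelow (q * d) φ                            ≡⟨ cong suc (count-multiples q d) ⟩
  suc q                                             ∎
  where
  open ≡-Reasoning
  φ : ℕ → ℕ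
  φ a = ind (d ∣? a) 1
  first-block : sumBelow d φ ≡ 1
  first-block = cong₂ _+_ (ind-yes (d ∣? 0) (d ∣0))
    (sumBelow-0 d-1 (λ a a< → ind-no (d ∣? suc a) (λ d∣ → <⇒≱ (s≤s a<) (∣⇒≤ d∣))))
  shift : ∀ x → x < q * d → φ (d + x) ≡ φ x
  shift x _ = ind-⇔ (λ h → ∣m+n∣m⇒∣n h ∣-refl) (∣m∣n⇒∣m+n ∣-refl) (d ∣? (d + x)) (d ∣? x)

2*nC2+n≡n*n : ∀ n → 2 * (n C 2) + n ≡ n * n
2*nC2+n≡n*n zero    = refl
2*nC2+n≡n*n (suc n) = begin
  2 * (suc n C 2) + suc n   ≡⟨ cong (λ z → 2 * z + suc n) (sym (nCk+nC[k+1]≡[n+1]C[k+1] n 1)) ⟩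
  2 * (n C 1 + n C 2) + suc n ≡⟨ cong (λ z → 2 * (z + n C 2) + suc n) (nC1≡n n) ⟩
  2 * (n + n C 2) + suc n   ≡⟨ solve 2 (λ n c → con 2 :* (n :+ c) :+ (con 1 :+ n) := con 2 :* n :+ con 1 :+ (con 2 :* c :+ n)) refl n (n C 2) ⟩
  2 * n + 1 + (2 * (n C 2) + n) ≡⟨ cong (2 * n + 1 +_) (2*nC2+n≡n*n n) ⟩
  2 * n + 1 + n * n         ≡⟨ solve 1 (λ n → con 2 :* n :+ con 1 :+ n :* n := (con 1 :+ n) :* (con 1 :+ n)) refl n ⟩
  suc n * suc n             ∎
  where open ≡-Reasoning

^-monoʳ-∣ : ∀ p {s t} → s ≤ t → p ^ s ∣ p ^ t
^-monoʳ-∣ p {s} {t} s≤t =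
  subst (p ^ s ∣_) (trans (sym (^-distribˡ-+-* p s (t ∸ s))) (cong (p ^_) (m+[n∸m]≡n s≤t))) (m∣m*n _)

%-absorbˡ : ∀ x y n .{{_ : NonZero n}} → ((x % n) * y) % n ≡ (x * y) % n
%-absorbˡ x y n = begin
  ((x % n) * y) % n           ≡⟨ %-distribˡ-* (x % n) y n ⟩
  ((x % n % n) * (y % n)) % n ≡⟨ cong (λ z → (z * (y % n)) % n) (m%n%n≡m%n x n) ⟩
  ((x % n) * (y % n)) % n     ≡⟨ sym (%-distribˡ-* x y n) ⟩
  (x * y) % n                 ∎
  where open ≡-Reasoning

%-inverse : ∀ u n .{{_ : NonZero n}} → Coprime u n → ∃[ u' ] (u * u') % n ≡ 1 % n
%-inverse u n c with coprime-Bézout c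
... | GCD.Bézout.+- x y 1+yn≡xu = x , (begin
  (u * x) % n         ≡⟨ cong (_% n) (trans (*-comm u x) (sym 1+yn≡xu)) ⟩
  (1 + y * n) % n     ≡⟨ [m+kn]%n≡m%n 1 y n ⟩
  1 % n               ∎)
  where open ≡-Reasoning
-- Here x * u ≡ -1, so x * (n - 1) inverts u.
%-inverse u n@(suc n-1) c | GCD.Bézout.-+ x y 1+xu≡yn = x * n-1 , (begin
  (u * (x * n-1)) % n                 ≡⟨ sym ([m+kn]%n≡m%n (u * (x * n-1)) 1 n) ⟩
  (u * (x * n-1) + 1 * n) % n         ≡⟨ cong (_% n) rearrange ⟩
  (1 + (y * n-1) * n) % n             ≡⟨ [m+kn]%n≡m%n 1 (y * n-1) n ⟩
  1 % n                               ∎)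
  where
  open ≡-Reasoning
  rearrange : u * (x * n-1) + 1 * n ≡ 1 + (y * n-1) * n
  rearrange = begin
    u * (x * n-1) + 1 * n ≡⟨ solve 3 (λ u x k → u :* (x :* k) :+ con 1 :* (con 1 :+ k) := (con 1 :+ x :* u) :* k :+ con 1) refl u x n-1 ⟩
    (1 + x * u) * n-1 + 1 ≡⟨ cong (λ z → z * n-1 + 1) 1+xu≡yn ⟩
    y * n * n-1 + 1       ≡⟨ solve 3 (λ y k n → y :* n :* k :+ con 1 := con 1 :+ (y :* k) :* n) refl y n-1 n ⟩
    1 + (y * n-1) * n     ∎

module _ {p : ℕ} (p-prime : Prime p) where

  prime∤⇒coprime : ∀ {u} → ¬ p ∣ u → Coprime u p
  prime∤⇒coprime p∤u (d∣u , d∣p) with prime⇒irreducible p-prime d∣p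
  ... | inj₁ d≡1 = d≡1
  ... | inj₂ refl = ⊥-elim (p∤u d∣u)

  prime∤⇒coprime-^ : ∀ {u} → ¬ p ∣ u → ∀ t → Coprime u (p ^ t)
  prime∤⇒coprime-^ p∤u zero    (_ , d∣1)       = ∣1⇒≡1 d∣1
  prime∤⇒coprime-^ p∤u (suc t) (d∣u , d∣p*pᵗ) =
    prime∤⇒coprime-^ p∤u t (d∣u , coprime-divisor d⊥p d∣p*pᵗ)
    where
    d⊥p : Coprime _ p
    d⊥p (e∣d , e∣p) = prime∤⇒coprime p∤u (∣-trans e∣d d∣u , e∣p)

-- val t a is the largest s ≤ t with p ^ s ∣ a (so val t 0 ≡ t).
module Valuation (p : ℕ) where

  val : ℕ → ℕ → ℕ
  val zero    a = 0
  val (suc t) a with p ^ suc t ∣? a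
  ... | yes _ = suc t
  ... | no  _ = val t a

  ^val∣ : ∀ t a → p ^ val t a ∣ a
  ^val∣ zero    a = 1∣ a
  ^val∣ (suc t) a with p ^ suc t ∣? a
  ... | yes pᵗ∣a = pᵗ∣a
  ... | no  _    = ^val∣ t a

  val≤ : ∀ t a → val t a ≤ t
  val≤ zero    a = z≤n
  val≤ (suc t) a with p ^ suc t ∣? a
  ... | yes _ = ≤-refl
  ... | no  _ = m≤n⇒m≤1+n (val≤ t a)

  ≤val : ∀ t a s → s ≤ t → p ^ s ∣ a → s ≤ val t a
  ≤val zero    a .zero z≤n _ = z≤n
  ≤val (suc t) a s s≤1+t pˢ∣a with p ^ suc t ∣? a
  ... | yes _  = s≤1+t
  ... | no  ∤a with m≤n⇒m<n∨m≡n s≤1+t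
  ...   | inj₁ s<1+t = ≤val t a s (s≤s⁻¹ s<1+t) pˢ∣a
  ...   | inj₂ refl  = ⊥-elim (∤a pˢ∣a)

_⊑_ : ℕ → ℕ → Set
x ⊑ y = x ≡ 0 ⊎ (1 ≤ y × y ≤ x)

_⊑?_ : ∀ x y → Dec (x ⊑ y)
x ⊑? y = (x ≟ 0) ⊎-dec ((1 ≤? y) ×-dec (y ≤? x))

-- class a is the exponent j of the paper's X^j containing a ∈ ℤ_{p^m}.
module ClassOf (p m : ℕ) where
  open Valuation p

  v : ℕ → ℕ
  v = val m

  class : ℕ → ℕ
  class zero    = 0
  class (suc a) = suc (v (suc a))

  v0≡m : v 0 ≡ m
  v0≡m = ≤-antisym (val≤ m 0) (≤val m 0 m ≤-refl (_ ∣0))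

  v<m : ∀ a → suc a < p ^ m → v (suc a) < m
  v<m a 1+a<pᵐ with m≤n⇒m<n∨m≡n (val≤ m (suc a))
  ... | inj₁ v<m = v<m
  ... | inj₂ v≡m = ⊥-elim (<⇒≱ 1+a<pᵐ (∣⇒≤ (subst (λ e → p ^ e ∣ suc a) v≡m (^val∣ m (suc a)))))

  class< : ∀ a → a < p ^ m → class a < suc m
  class< zero    _      = z<s
  class< (suc a) a<pᵐ = s<s (v<m a a<pᵐ)

  cls : Fin (p ^ m) → Fin (suc m)
  cls a = fromℕ< (class< (toℕ a) (FP.toℕ<n a))

  toℕ-cls : ∀ a → toℕ (cls a) ≡ class (toℕ a)
  toℕ-cls a = FP.toℕ-fromℕ< _

  v≤⇒⊑ : ∀ a b → a < p ^ m → v b ≤ v a → class a ⊑ class b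
  v≤⇒⊑ zero    b       _      _   = inj₁ refl
  v≤⇒⊑ (suc a) zero    a<pᵐ v≤v = ⊥-elim (<⇒≱ (v<m a a<pᵐ) (subst (_≤ v (suc a)) v0≡m v≤v))
  v≤⇒⊑ (suc a) (suc b) _      v≤v = inj₂ (s≤s z≤n , s≤s v≤v)

  ⊑⇒v≤ : ∀ a b → class a ⊑ class b → v b ≤ v a
  ⊑⇒v≤ zero    b       _                  = subst (v b ≤_) (sym v0≡m) (val≤ m b)
  ⊑⇒v≤ (suc a) (suc b) (inj₂ (_ , v≤v)) = s≤s⁻¹ v≤v

-- Classes.factor ignores the parameters of Classes, so any instance will do.
classSize : ℕ → ℕ → ℕ → ℕ
classSize = Classes.factor 0 (λ ()) (λ ())

factor≡classSize : ∀ k (p m : Fin k → ℕ) q e t → Classes.factor k p m q e t ≡ classSize q e t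
factor≡classSize k p m q e zero    = refl
factor≡classSize k p m q e (suc t) = refl

module ClassCount (p m : ℕ) .{{_ : NonZero p}} where
  open Valuation p
  open ClassOf p m

  count-^∣ : ∀ s → s ≤ m → sumBelow (p ^ m) (λ a → ind (p ^ s ∣? a) 1) ≡ p ^ (m ∸ s)
  count-^∣ s s≤m = subst (λ N → sumBelow N (λ a → ind (p ^ s ∣? a) 1) ≡ p ^ (m ∸ s))
    (sym pᵐ≡pᵐ⁻ˢ*pˢ) (count-multiples (p ^ (m ∸ s)) (p ^ s) {{m^n≢0 p s}})
    where
    pᵐ≡pᵐ⁻ˢ*pˢ : p ^ m ≡ p ^ (m ∸ s) * p ^ s
    pᵐ≡pᵐ⁻ˢ*pˢ = trans (cong (p ^_) (sym (m∸n+n≡m s≤m))) (^-distribˡ-+-* p (m ∸ s) s)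

  class-split : ∀ t → t < m → ∀ a →
    ind (class a ≟ suc t) 1 + ind (p ^ suc t ∣? a) 1 ≡ ind (p ^ t ∣? a) 1
  class-split t t<m zero = trans
    (cong₂ _+_ (ind-no (0 ≟ suc t) {1} (λ ())) (ind-yes (p ^ suc t ∣? 0) {1} (_ ∣0)))
    (sym (ind-yes (p ^ t ∣? 0) (_ ∣0)))
  class-split t t<m (suc a) with v (suc a) ≟ t
  ... | yes refl = trans
    (cong₂ _+_ (ind-yes (class (suc a) ≟ suc t) refl)
               (ind-no (p ^ suc t ∣? suc a) (λ h → <⇒≱ (n<1+n t) (≤val m (suc a) (suc t) t<m h))))
    (sym (ind-yes (p ^ t ∣? suc a) (^val∣ m (suc a))))
  ... | no v≢t with p ^ suc t ∣? suc a
  ...   | yes pᵗ⁺¹∣a = trans (cong (_+ 1) (ind-no (class (suc a) ≟ suc t) (v≢t ∘ suc-injective)))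
                         (sym (ind-yes (p ^ t ∣? suc a) (∣-trans (n∣m*n p) pᵗ⁺¹∣a)))
  ...   | no pᵗ⁺¹∤a = trans (+-identityʳ _) (trans
      (ind-no (class (suc a) ≟ suc t) (v≢t ∘ suc-injective))
      (sym (ind-no (p ^ t ∣? suc a) (λ pᵗ∣a → pᵗ⁺¹∤a (∣-trans (^-monoʳ-∣ p (t<v pᵗ∣a)) (^val∣ m (suc a)))))))
    where
    t<v : p ^ t ∣ suc a → t < v (suc a)
    t<v pᵗ∣a = ≤∧≢⇒< (≤val m (suc a) t (<⇒≤ t<m) pᵗ∣a) (v≢t ∘ sym)

  count-class : ∀ c → c < suc m → sumBelow (p ^ m) (λ a → ind (class a ≟ c) 1) ≡ classSize p m c
  count-class zero    _ = count-zero (p ^ m) {{m^n≢0 p m}}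
    where
    count-zero : ∀ n .{{_ : NonZero n}} → sumBelow n (λ a → ind (class a ≟ 0) 1) ≡ 1
    count-zero (suc n) = cong suc (sumBelow-0 n (λ _ _ → refl))
  count-class (suc t) c<1+m = begin
    count                                     ≡⟨ sym (m+n∸n≡m count (p ^ (m ∸ suc t))) ⟩
    count + p ^ (m ∸ suc t) ∸ p ^ (m ∸ suc t) ≡⟨ cong (_∸ p ^ (m ∸ suc t)) count+pᵐ⁻ᵗ⁻¹≡pᵐ⁻ᵗ ⟩
    p ^ (m ∸ t) ∸ p ^ (m ∸ suc t)             ≡⟨ cong (λ e → p ^ e ∸ p ^ (m ∸ suc t)) (sym (∸-suc+1 m t<m)) ⟩
    classSize p m (suc t)                     ∎
    where
    open ≡-Reasoning
    t<m = s≤s⁻¹ c<1+m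
    count = sumBelow (p ^ m) (λ a → ind (class a ≟ suc t) 1)
    count+pᵐ⁻ᵗ⁻¹≡pᵐ⁻ᵗ : count + p ^ (m ∸ suc t) ≡ p ^ (m ∸ t)
    count+pᵐ⁻ᵗ⁻¹≡pᵐ⁻ᵗ = begin
      count + p ^ (m ∸ suc t)
        ≡⟨ cong (count +_) (sym (count-^∣ (suc t) t<m)) ⟩
      count + sumBelow (p ^ m) (λ a → ind (p ^ suc t ∣? a) 1)
        ≡⟨ sym (sumBelow-distrib (p ^ m) _ _) ⟩
      sumBelow (p ^ m) (λ a → ind (class a ≟ suc t) 1 + ind (p ^ suc t ∣? a) 1)
        ≡⟨ sumBelow-cong (p ^ m) (λ a _ → class-split t t<m a) ⟩
      sumBelow (p ^ m) (λ a → ind (p ^ t ∣? a) 1)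
        ≡⟨ count-^∣ t (<⇒≤ t<m) ⟩
      p ^ (m ∸ t) ∎
    ∸-suc+1 : ∀ n {t} → t < n → n ∸ suc t + 1 ≡ n ∸ t
    ∸-suc+1 (suc n) {zero}  _         = +-comm n 1
    ∸-suc+1 (suc n) {suc t} (s≤s t<n) = ∸-suc+1 n t<n

  count-cls : ∀ c → sum (map (λ a → ind (cls a F.≟ c) 1) (allFin (p ^ m))) ≡ classSize p m (toℕ c)
  count-cls c = begin
    sum (map (λ a → ind (cls a F.≟ c) 1) (allFin (p ^ m)))
      ≡⟨ sum-map-cong (λ a → ind-⇔ (λ e → trans (sym (toℕ-cls a)) (cong toℕ e))
                                   (λ e → FP.toℕ-injective (trans (toℕ-cls a) e))
                                   (cls a F.≟ c) (class (toℕ a) ≟ toℕ c)) (allFin (p ^ m)) ⟩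
    sum (map (λ a → ind (class (toℕ a) ≟ toℕ c) 1) (allFin (p ^ m)))
      ≡⟨ sum-allFin-toℕ (p ^ m) (λ a → ind (class a ≟ toℕ c) 1) ⟩
    sumBelow (p ^ m) (λ a → ind (class a ≟ toℕ c) 1) ≡⟨ count-class (toℕ c) (FP.toℕ<n c) ⟩
    classSize p m (toℕ c) ∎
    where open ≡-Reasoning

  sum-cls : ∀ (h : Fin (suc m) → ℕ) →
    sum (map (h ∘ cls) (allFin (p ^ m))) ≡ sum (map (λ c → classSize p m (toℕ c) * h c) (allFin (suc m)))
  sum-cls h = begin
    sum (map (h ∘ cls) As)
      ≡⟨ sum-map-cong (λ a → sym (sum-allFin-select (suc m) (cls a) h)) As ⟩
    sum (map (λ a → sum (map (λ c → ind (cls a F.≟ c) (h c)) Cs)) As)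
      ≡⟨ sum-swap (λ a c → ind (cls a F.≟ c) (h c)) As Cs ⟩
    sum (map (λ c → sum (map (λ a → ind (cls a F.≟ c) (h c)) As)) Cs)
      ≡⟨ sum-map-cong (λ c → sum-map-cong (λ a → ind≡ind1* (cls a F.≟ c) (h c)) As) Cs ⟩
    sum (map (λ c → sum (map (λ a → ind (cls a F.≟ c) 1 * h c) As)) Cs)
      ≡⟨ sum-map-cong (λ c → trans (sum-map-*ʳ (h c) _ As) (cong (_* h c) (count-cls c))) Cs ⟩
    sum (map (λ c → classSize p m (toℕ c) * h c) Cs) ∎
    where
    open ≡-Reasoning
    As = allFin (p ^ m)
    Cs = allFin (suc m)

module PrimePower (p m : ℕ) (p-prime : Prime p) (1≤m : 1 ≤ m) where
  open Valuation p
  open ClassOf p m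

  instance
    p≢0 : NonZero p
    p≢0 = prime⇒nonZero p-prime
    pᵐ≢0 : NonZero (p ^ m)
    pᵐ≢0 = m^n≢0 p m

  1<p : 1 < p
  1<p = nonTrivial⇒n>1 p {{prime⇒nonTrivial p-prime}}

  1<pᵐ : 1 < p ^ m
  1<pᵐ = <-≤-trans 1<p (subst (_≤ p ^ m) (*-identityʳ p) (^-monoʳ-≤ p 1≤m))

  1%pᵐ≡1 : 1 % p ^ m ≡ 1
  1%pᵐ≡1 = m<n⇒m%n≡m 1<pᵐ

  ∈⇒v≤ : ∀ a b r → a ≡ (r * b) % p ^ m → v b ≤ v a
  ∈⇒v≤ a b r a≡rb = ≤val m a (v b) (val≤ m b)
    (subst (p ^ v b ∣_) (sym a≡rb) (%-presˡ-∣ (∣n⇒∣m*n r (^val∣ m b)) (^-monoʳ-∣ p (val≤ m b))))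

  -- Write b = p^(v b) u and a = p^(v b) w; then u is invertible and a = (w u⁻¹) b.
  v≤⇒∈ : ∀ a b → a < p ^ m → b < p ^ m → v b ≤ v a → ∃[ r ] r < p ^ m × a ≡ (r * b) % p ^ m
  v≤⇒∈ zero    zero    _    _   _   = 0 , >-nonZero⁻¹ (p ^ m) , sym (m<n⇒m%n≡m (>-nonZero⁻¹ (p ^ m)))
  v≤⇒∈ (suc a) zero    a<pᵐ _   v≤v = ⊥-elim (<⇒≱ (v<m a a<pᵐ) (subst (_≤ v (suc a)) v0≡m v≤v))
  v≤⇒∈ a       (suc b) a<pᵐ b<pᵐ v≤v with ^val∣ m (suc b) | ∣-trans (^-monoʳ-∣ p v≤v) (^val∣ m a)
  ... | divides u b≡ud | divides w a≡wd = r , m%n<n (w * u⁻¹) (p ^ m) , sym (begin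
    (r * suc b) % p ^ m              ≡⟨ %-absorbˡ (w * u⁻¹) (suc b) (p ^ m) ⟩
    (w * u⁻¹ * suc b) % p ^ m        ≡⟨ cong (λ z → (w * u⁻¹ * z) % p ^ m) b≡ud ⟩
    (w * u⁻¹ * (u * d)) % p ^ m      ≡⟨ cong (_% p ^ m) (solve 4 (λ w u' u d → w :* u' :* (u :* d) := u :* u' :* (w :* d)) refl w u⁻¹ u d) ⟩
    (u * u⁻¹ * (w * d)) % p ^ m      ≡⟨ sym (%-absorbˡ (u * u⁻¹) (w * d) (p ^ m)) ⟩
    ((u * u⁻¹) % p ^ m * (w * d)) % p ^ m ≡⟨ cong (λ z → (z * (w * d)) % p ^ m) (proj₂ inverse) ⟩
    (1 % p ^ m * (w * d)) % p ^ m    ≡⟨ %-absorbˡ 1 (w * d) (p ^ m) ⟩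
    (1 * (w * d)) % p ^ m            ≡⟨ cong (_% p ^ m) (trans (*-identityˡ (w * d)) (sym a≡wd)) ⟩
    a % p ^ m                        ≡⟨ m<n⇒m%n≡m a<pᵐ ⟩
    a                                ∎)
    where
    open ≡-Reasoning
    d = p ^ v (suc b)
    p∤u : ¬ p ∣ u
    p∤u p∣u = <⇒≱ (n<1+n _) (≤val m (suc b) (suc (v (suc b))) (v<m b b<pᵐ)
                (subst (p * d ∣_) (sym b≡ud) (*-monoˡ-∣ d p∣u)))
    inverse = %-inverse u (p ^ m) (prime∤⇒coprime-^ p-prime p∤u m)
    u⁻¹ = proj₁ inverse
    r = (w * u⁻¹) % p ^ m

  ∈⇒⊑ : ∀ a b r → a < p ^ m → a ≡ (r * b) % p ^ m → class a ⊑ class b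
  ∈⇒⊑ a b r a<pᵐ a≡rb = v≤⇒⊑ a b a<pᵐ (∈⇒v≤ a b r a≡rb)

  ⊑⇒∈ : ∀ a b → a < p ^ m → b < p ^ m → class a ⊑ class b → ∃[ r ] r < p ^ m × a ≡ (r * b) % p ^ m
  ⊑⇒∈ a b a<pᵐ b<pᵐ a⊑b = v≤⇒∈ a b a<pᵐ b<pᵐ (⊑⇒v≤ a b a⊑b)

  rep : ℕ → ℕ
  rep zero    = 0
  rep (suc t) = p ^ t

  rep< : ∀ c → c < suc m → rep c < p ^ m
  rep< zero    _      = >-nonZero⁻¹ (p ^ m)
  rep< (suc t) 1+t<1+m = ^-monoʳ-< p 1<p (s≤s⁻¹ 1+t<1+m)

  v-^ : ∀ {t} → t ≤ m → v (p ^ t) ≡ t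
  v-^ {t} t≤m = ≤-antisym v≤t (≤val m (p ^ t) t t≤m ∣-refl)
    where
    v≤t : v (p ^ t) ≤ t
    v≤t with v (p ^ t) ≤? t
    ... | yes v≤t = v≤t
    ... | no  v≰t = ⊥-elim (<⇒≱ (^-monoʳ-< p 1<p (n<1+n t))
            (∣⇒≤ {{m^n≢0 p t}} (∣-trans (^-monoʳ-∣ p (≰⇒> v≰t)) (^val∣ m (p ^ t)))))

  class-rep : ∀ c → c < suc m → class (rep c) ≡ c
  class-rep zero    _        = refl
  class-rep (suc t) 1+t<1+m = trans (class≢0 (p ^ t) {{m^n≢0 p t}}) (cong suc (v-^ (<⇒≤ (s≤s⁻¹ 1+t<1+m))))
    where
    class≢0 : ∀ a .{{_ : NonZero a}} → class a ≡ suc (v a)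
    class≢0 (suc a) = refl

  -- a is a unit iff 1 ∈ ℤ a, and class 1 ≡ 1.
  unit⇒class≡1 : ∀ a r → (a * r) % p ^ m ≡ 1 % p ^ m → class a ≡ 1
  unit⇒class≡1 a r ar≡1 with ∈⇒⊑ 1 a r 1<pᵐ (sym (trans (cong (_% p ^ m) (*-comm r a)) (trans ar≡1 1%pᵐ≡1)))
  ... | inj₂ (1≤ca , ca≤c1) = ≤-antisym (subst (class a ≤_) (class-rep 1 (s≤s 1≤m)) ca≤c1) 1≤ca

  class≡1⇒unit : ∀ a → a < p ^ m → class a ≡ 1 → ∃[ r ] r < p ^ m × (a * r) % p ^ m ≡ 1 % p ^ m
  class≡1⇒unit a a<pᵐ ca≡1 with ⊑⇒∈ 1 a 1<pᵐ a<pᵐ c1⊑ca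
    where
    c1⊑ca : class 1 ⊑ class a
    c1⊑ca = inj₂ (≤-reflexive (sym ca≡1) , ≤-reflexive (trans ca≡1 (sym (class-rep 1 (s≤s 1≤m)))))
  ... | r , r<pᵐ , 1≡ra = r , r<pᵐ , trans (cong (_% p ^ m) (*-comm a r)) (trans (sym 1≡ra) (sym 1%pᵐ≡1))

_≃_ : ∀ {k} {n : Fin k → ℕ} → Tuple k n → Tuple k n → Set
j ≃ l = ∀ i → toℕ (j i) ≡ toℕ (l i)

≃-sym : ∀ {k} {n : Fin k → ℕ} {j l : Tuple k n} → j ≃ l → l ≃ j
≃-sym j≃l = sym ∘ j≃l

except-one : ∀ {k} {P : Pred (Fin k) 0ℓ} → Decidable P → (b : Fin k) →
             (∃ λ a → a ≢ b × ¬ P a) ⊎ (∀ a → a ≢ b → P a)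
except-one P? b with FP.any? (λ a → ¬? (a F.≟ b) ×-dec ¬? (P? a))
... | yes (a , a≢b , ¬Pa) = inj₁ (a , a≢b , ¬Pa)
... | no  none            = inj₂ (λ a a≢b → decidable-stable (P? a) (λ ¬Pa → none (a , a≢b , ¬Pa)))

module ClassRelations (k : ℕ) (p m : Fin k → ℕ) where
  open Classes k p m

  CommonNeighbour : Idx → Idx → Set
  CommonNeighbour j l = Σ Idx λ z → InJ z × ClassAdj j z × ClassAdj z l

  ≼-refl : ∀ j → j ≼ j
  ≼-refl j i with toℕ (j i) ≟ 0
  ... | yes jᵢ≡0 = inj₁ jᵢ≡0
  ... | no  jᵢ≢0 = inj₂ (n≢0⇒n>0 jᵢ≢0 , ≤-refl)

  ≼-resp : ∀ {j j' l l'} → j ≃ j' → l ≃ l' → j ≼ l → j' ≼ l'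
  ≼-resp j≃j' l≃l' j≼l i with j≼l i
  ... | inj₁ jᵢ≡0          = inj₁ (trans (sym (j≃j' i)) jᵢ≡0)
  ... | inj₂ (1≤lᵢ , lᵢ≤jᵢ) = inj₂ (subst (1 ≤_) (l≃l' i) 1≤lᵢ , subst₂ _≤_ (l≃l' i) (j≃j' i) lᵢ≤jᵢ)

  ¬≼-at : ∀ {j l} i → toℕ (j i) ≢ 0 → ¬ (1 ≤ toℕ (l i) × toℕ (l i) ≤ toℕ (j i)) → ¬ j ≼ l
  ¬≼-at i jᵢ≢0 ¬lᵢ≤jᵢ j≼l with j≼l i
  ... | inj₁ jᵢ≡0    = jᵢ≢0 jᵢ≡0
  ... | inj₂ lᵢ≤jᵢ = ¬lᵢ≤jᵢ lᵢ≤jᵢ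

  ¬≼-zero : ∀ {j l} i → toℕ (j i) ≢ 0 → toℕ (l i) ≡ 0 → ¬ j ≼ l
  ¬≼-zero i jᵢ≢0 lᵢ≡0 = ¬≼-at i jᵢ≢0 (λ (1≤lᵢ , _) → <⇒≱ 1≤lᵢ (≤-reflexive lᵢ≡0))

  ClassAdj-sym : ∀ {j l} → ClassAdj j l → ClassAdj l j
  ClassAdj-sym (j⋠l , l⋠j) = l⋠j , j⋠l

  ClassAdj-irrefl : ∀ j → ¬ ClassAdj j j
  ClassAdj-irrefl j (j⋠j , _) = j⋠j (≼-refl j)

  ClassAdj-resp : ∀ {j j' l l'} → j ≃ j' → l ≃ l' → ClassAdj j l → ClassAdj j' l'
  ClassAdj-resp j≃j' l≃l' (j⋠l , l⋠j) =
    j⋠l ∘ ≼-resp (≃-sym j≃j') (≃-sym l≃l') , l⋠j ∘ ≼-resp (≃-sym l≃l') (≃-sym j≃j')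

  InJ-resp : ∀ {j j'} → j ≃ j' → InJ j → InJ j'
  InJ-resp j≃j' (j≢0 , j≢1) = (λ j'≡0 → j≢0 (λ i → trans (j≃j' i) (j'≡0 i)))
                            , (λ j'≡1 → j≢1 (λ i → trans (j≃j' i) (j'≡1 i)))

  S₀-resp : ∀ {j j' l l'} → j ≃ j' → l ≃ l' → S₀ j l → S₀ j' l'
  S₀-resp j≃j' l≃l' (r , 2≤jᵣ , 2≤lᵣ , lᵣ≤jᵣ , off-r) =
    r , subst (2 ≤_) (j≃j' r) 2≤jᵣ , subst (2 ≤_) (l≃l' r) 2≤lᵣ , subst₂ _≤_ (l≃l' r) (j≃j' r) lᵣ≤jᵣ ,
    λ i i≢r → trans (sym (j≃j' i)) (proj₁ (off-r i i≢r)) , trans (sym (l≃l' i)) (proj₂ (off-r i i≢r))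

  InS-resp : ∀ {j j' l l'} → j ≃ j' → l ≃ l' → InS j l → InS j' l'
  InS-resp j≃j' l≃l' (inj₁ s) = inj₁ (S₀-resp j≃j' l≃l' s)
  InS-resp j≃j' l≃l' (inj₂ s) = inj₂ (S₀-resp l≃l' j≃j' s)

  InS-sym : ∀ {j l} → InS j l → InS l j
  InS-sym (inj₁ s) = inj₂ s
  InS-sym (inj₂ s) = inj₁ s

  S₀⇒≼ : ∀ {j l} → S₀ j l → j ≼ l
  S₀⇒≼ (r , _ , 2≤lᵣ , lᵣ≤jᵣ , off-r) i with i F.≟ r
  ... | yes refl = inj₂ (≤-trans (s≤s z≤n) 2≤lᵣ , lᵣ≤jᵣ)
  ... | no  i≢r  = inj₁ (proj₁ (off-r i i≢r))

  InS⇒¬ClassAdj : ∀ {j l} → InS j l → ¬ ClassAdj j l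
  InS⇒¬ClassAdj (inj₁ s) (j⋠l , _)   = j⋠l (S₀⇒≼ s)
  InS⇒¬ClassAdj (inj₂ s) (_   , l⋠j) = l⋠j (S₀⇒≼ s)

  -- Off r, l is 1 and j is 0, so every z lies above j or below l.
  S₀⇒≼⊎≼ : ∀ {j l} → S₀ j l → ∀ z → j ≼ z ⊎ z ≼ l
  S₀⇒≼⊎≼ {j} {l} (r , _ , 2≤lᵣ , lᵣ≤jᵣ , off-r) z with toℕ (z r) ⊑? toℕ (l r)
  ... | yes zᵣ⊑lᵣ = inj₂ z≼l
    where
    z≼l : z ≼ l
    z≼l i with i F.≟ r
    ... | yes refl = zᵣ⊑lᵣ
    ... | no  i≢r with toℕ (z i) ≟ 0
    ...   | yes zᵢ≡0 = inj₁ zᵢ≡0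
    ...   | no  zᵢ≢0 = inj₂ (subst (λ t → 1 ≤ t × t ≤ toℕ (z i)) (sym (proj₂ (off-r i i≢r))) (s≤s z≤n , n≢0⇒n>0 zᵢ≢0))
  ... | no  zᵣ⋢lᵣ = inj₁ j≼z
    where
    j≼z : j ≼ z
    j≼z i with i F.≟ r
    ... | yes refl = inj₂ (n≢0⇒n>0 (zᵣ⋢lᵣ ∘ inj₁)
                          , ≤-trans (<⇒≤ (≰⇒> (λ lᵣ≤zᵣ → zᵣ⋢lᵣ (inj₂ (≤-trans (s≤s z≤n) 2≤lᵣ , lᵣ≤zᵣ))))) lᵣ≤jᵣ)
    ... | no  i≢r  = inj₁ (proj₁ (off-r i i≢r))

  InS⇒¬CommonNeighbour : ∀ {j l} → InS j l → ¬ CommonNeighbour j l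
  InS⇒¬CommonNeighbour (inj₁ s) (z , _ , (j⋠z , _) , (z⋠l , _)) with S₀⇒≼⊎≼ s z
  ... | inj₁ j≼z = j⋠z j≼z
  ... | inj₂ z≼l = z⋠l z≼l
  InS⇒¬CommonNeighbour (inj₂ s) (z , _ , (_ , z⋠j) , (_ , l⋠z)) with S₀⇒≼⊎≼ s z
  ... | inj₁ l≼z = l⋠z l≼z
  ... | inj₂ z≼j = z⋠j z≼j

another : ∀ {k} → 2 ≤ k → (r : Fin k) → ∃ λ s → s ≢ r
another (s≤s (s≤s _)) fzero    = fsuc fzero , λ ()
another (s≤s (s≤s _)) (fsuc r) = fzero , λ ()

≡1⇒≢0 : ∀ {n} → n ≡ 1 → n ≢ 0
≡1⇒≢0 refl ()

module ClassGraph (k : ℕ) (p m : Fin k → ℕ) (1≤m : ∀ i → 1 ≤ m i) (2≤k : 2 ≤ k) where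
  open Classes k p m
  open ClassRelations k p m

  Path₃ : Idx → Idx → Set
  Path₃ j l = Σ Idx λ z → InJ z × ClassAdj j z × CommonNeighbour z l

  ¬S₀-refl : ∀ j → ¬ S₀ j j
  ¬S₀-refl j (r , _ , _ , _ , off-r) with another 2≤k r
  ... | s , s≢r = 0≢1+n (trans (sym (proj₁ (off-r s s≢r))) (proj₂ (off-r s s≢r)))

  ¬InS-refl : ∀ j → ¬ InS j j
  ¬InS-refl j = [ ¬S₀-refl j , ¬S₀-refl j ]′

  one : ∀ i → Fin (suc (m i))
  one i = fromℕ< (s≤s (1≤m i))

  -- δ a is the class of the idempotent e_a (1 at a, 0 elsewhere), δᶜ a that of 1 - e_a.
  δ δᶜ : Fin k → Idx
  δ a i with i F.≟ a
  ... | yes _ = one i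
  ... | no  _ = fzero
  δᶜ a i with i F.≟ a
  ... | yes _ = fzero
  ... | no  _ = one i

  δ-at : ∀ a → toℕ (δ a a) ≡ 1
  δ-at a with a F.≟ a
  ... | yes _   = FP.toℕ-fromℕ< (s≤s (1≤m a))
  ... | no  a≢a = ⊥-elim (a≢a refl)

  δ-off : ∀ a i → i ≢ a → toℕ (δ a i) ≡ 0
  δ-off a i i≢a with i F.≟ a
  ... | yes i≡a = ⊥-elim (i≢a i≡a)
  ... | no  _   = refl

  δᶜ-at : ∀ a → toℕ (δᶜ a a) ≡ 0
  δᶜ-at a with a F.≟ a
  ... | yes _   = refl
  ... | no  a≢a = ⊥-elim (a≢a refl)

  δᶜ-off : ∀ a i → i ≢ a → toℕ (δᶜ a i) ≡ 1
  δᶜ-off a i i≢a with i F.≟ a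
  ... | yes i≡a = ⊥-elim (i≢a i≡a)
  ... | no  _   = FP.toℕ-fromℕ< (s≤s (1≤m i))

  InJ-δ : ∀ a → InJ (δ a)
  InJ-δ a = (λ δ≡0 → ≡1⇒≢0 (δ-at a) (δ≡0 a))
          , (λ δ≡1 → let (s , s≢a) = another 2≤k a in ≡1⇒≢0 (δ≡1 s) (δ-off a s s≢a))

  InJ-δᶜ : ∀ a → InJ (δᶜ a)
  InJ-δᶜ a = (λ δᶜ≡0 → let (s , s≢a) = another 2≤k a in ≡1⇒≢0 (δᶜ-off a s s≢a) (δᶜ≡0 s))
           , (λ δᶜ≡1 → ≡1⇒≢0 (δᶜ≡1 a) (δᶜ-at a))

  -- The path j — δᶜ r — δ r — l.
  S₀⇒Path₃ : ∀ {j l} → S₀ j l → Path₃ j l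
  S₀⇒Path₃ {j} {l} (r , 2≤jᵣ , 2≤lᵣ , _ , off-r) =
    δᶜ r , InJ-δᶜ r , (¬≼-zero r jᵣ≢0 (δᶜ-at r) , ¬≼-zero s (≡1⇒≢0 (δᶜ-off r s s≢r)) jₛ≡0) ,
    δ r , InJ-δ r ,
    (¬≼-zero s (≡1⇒≢0 (δᶜ-off r s s≢r)) (δ-off r s s≢r) , ¬≼-zero r (≡1⇒≢0 (δ-at r)) (δᶜ-at r)) ,
    (¬≼-at r (≡1⇒≢0 (δ-at r)) (λ (_ , lᵣ≤1) → <⇒≱ 2≤lᵣ (subst (toℕ (l r) ≤_) (δ-at r) lᵣ≤1)) ,
     ¬≼-zero s (≡1⇒≢0 lₛ≡1) (δ-off r s s≢r))
    where
    s = proj₁ (another 2≤k r)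
    s≢r = proj₂ (another 2≤k r)
    jₛ≡0 = proj₁ (off-r s s≢r)
    lₛ≡1 = proj₂ (off-r s s≢r)
    jᵣ≢0 : toℕ (j r) ≢ 0
    jᵣ≢0 jᵣ≡0 = <⇒≱ 2≤jᵣ (≤-trans (≤-reflexive jᵣ≡0) z≤n)

  InS⇒Path₃ : ∀ {j l} → InS j l → Path₃ j l
  InS⇒Path₃ (inj₁ s) = S₀⇒Path₃ s
  InS⇒Path₃ (inj₂ s) with S₀⇒Path₃ s
  ... | z₁ , J₁ , l~z₁ , z₂ , J₂ , z₁~z₂ , z₂~j =
    z₂ , J₂ , ClassAdj-sym z₂~j , z₁ , J₁ , ClassAdj-sym z₁~z₂ , ClassAdj-sym l~z₁

  δᶜ-CommonNeighbour : ∀ {j l} → j ≼ l → ∀ a b → toℕ (j a) ≢ 0 → b ≢ a → toℕ (l b) ≢ 1 →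
                       CommonNeighbour j l
  δᶜ-CommonNeighbour {j} {l} j≼l a b jₐ≢0 b≢a l_b≢1 =
    δᶜ a , InJ-δᶜ a , (¬≼-zero a jₐ≢0 (δᶜ-at a) , δᶜ⋠j) , (δᶜ⋠l , ¬≼-zero a lₐ≢0 (δᶜ-at a))
    where
    δᶜ_b≡1 = δᶜ-off a b b≢a
    δᶜ⋠j : ¬ δᶜ a ≼ j
    δᶜ⋠j = ¬≼-at b (≡1⇒≢0 δᶜ_b≡1) λ (1≤j_b , j_b≤1) → case j≼l b of λ where
      (inj₁ j_b≡0)           → <⇒≱ 1≤j_b (≤-reflexive j_b≡0)
      (inj₂ (1≤l_b , l_b≤j_b)) → l_b≢1 (≤-antisym (≤-trans l_b≤j_b (subst (toℕ (j b) ≤_) δᶜ_b≡1 j_b≤1)) 1≤l_b)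
    δᶜ⋠l : ¬ δᶜ a ≼ l
    δᶜ⋠l = ¬≼-at b (≡1⇒≢0 δᶜ_b≡1)
             (λ (1≤l_b , l_b≤1) → l_b≢1 (≤-antisym (subst (toℕ (l b) ≤_) δᶜ_b≡1 l_b≤1) 1≤l_b))
    lₐ≢0 : toℕ (l a) ≢ 0
    lₐ≢0 lₐ≡0 with j≼l a
    ... | inj₁ jₐ≡0      = jₐ≢0 jₐ≡0
    ... | inj₂ (1≤lₐ , _) = <⇒≱ 1≤lₐ (≤-reflexive lₐ≡0)

  concentrated⇒S₀ : ∀ {j l} → j ≼ l → ∀ b → toℕ (j b) ≢ 0 → toℕ (l b) ≢ 1 →
                    (∀ a → a ≢ b → toℕ (j a) ≡ 0) → (∀ a → a ≢ b → toℕ (l a) ≡ 1) → S₀ j l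
  concentrated⇒S₀ {j} {l} j≼l b j_b≢0 l_b≢1 j-off l-off with j≼l b
  ... | inj₁ j_b≡0              = ⊥-elim (j_b≢0 j_b≡0)
  ... | inj₂ (1≤l_b , l_b≤j_b) =
    b , ≤-trans 2≤l_b l_b≤j_b , 2≤l_b , l_b≤j_b , λ a a≢b → j-off a a≢b , l-off a a≢b
    where
    2≤l_b = ≤∧≢⇒< 1≤l_b (l_b≢1 ∘ sym)

  ≼⇒CommonNeighbour : ∀ {j l} → j ≼ l → InJ j → InJ l → ¬ S₀ j l → CommonNeighbour j l
  ≼⇒CommonNeighbour {j} {l} j≼l (j≢0 , _) (_ , l≢1) ¬S
    with FP.¬∀⟶∃¬ k (λ i → toℕ (l i) ≡ 1) (λ i → toℕ (l i) ≟ 1) l≢1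
  ... | b , l_b≢1 with except-one (λ a → toℕ (j a) ≟ 0) b
  ...   | inj₁ (a , a≢b , jₐ≢0) = δᶜ-CommonNeighbour j≼l a b jₐ≢0 (a≢b ∘ sym) l_b≢1
  ...   | inj₂ j-off with toℕ (j b) ≟ 0
  ...     | yes j_b≡0 = ⊥-elim (j≢0 λ a → case a F.≟ b of λ where
                          (yes refl) → j_b≡0
                          (no a≢b)   → j-off a a≢b)
  ...     | no  j_b≢0 with except-one (λ a → toℕ (l a) ≟ 1) b
  ...       | inj₁ (b' , b'≢b , l_b'≢1) = δᶜ-CommonNeighbour j≼l b b' j_b≢0 b'≢b l_b'≢1
  ...       | inj₂ l-off = ⊥-elim (¬S (concentrated⇒S₀ j≼l b j_b≢0 l_b≢1 j-off l-off))

  ¬InS⇒CommonNeighbour : ∀ {j l} → InJ j → InJ l → ¬ ClassAdj j l → ¬ InS j l → CommonNeighbour j l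
  ¬InS⇒CommonNeighbour {j} {l} Jj Jl ¬j~l ¬S with ≼? j l | ≼? l j
  ... | yes j≼l | _       = ≼⇒CommonNeighbour j≼l Jj Jl (¬S ∘ inj₁)
  ... | no  _   | yes l≼j with ≼⇒CommonNeighbour l≼j Jl Jj (¬S ∘ inj₂)
  ...   | z , Jz , l~z , z~j = z , Jz , ClassAdj-sym z~j , ClassAdj-sym l~z
  ¬InS⇒CommonNeighbour Jj Jl ¬j~l ¬S | no j⋠l | no l⋠j = ⊥-elim (¬j~l (j⋠l , l⋠j))

tupleSetoid : (k : ℕ) (n : Fin k → ℕ) → Setoid 0ℓ 0ℓ
tupleSetoid k n = record
  { Carrier       = Tuple k n
  ; _≈_           = λ x y → ∀ i → x i ≡ y i
  ; isEquivalence = record { refl = λ _ → refl ; sym = λ x≈y → sym ∘ x≈y ; trans = λ x≈y y≈z i → trans (x≈y i) (y≈z i) }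
  }

concatMap-map≡cartesianProductWith : ∀ {A B C : Set} (f : A → B → C) xs ys →
  concatMap (λ x → map (f x) ys) xs ≡ cartesianProductWith f xs ys
concatMap-map≡cartesianProductWith f []       ys = refl
concatMap-map≡cartesianProductWith f (x ∷ xs) ys =
  cong (map (f x) ys ++_) (concatMap-map≡cartesianProductWith f xs ys)

allTuples-unique : ∀ k (n : Fin k → ℕ) → Unique (tupleSetoid k n) (allTuples k n)
allTuples-unique zero    n = [] ∷ []
allTuples-unique (suc k) n =
  subst (Unique (tupleSetoid (suc k) n)) (sym (concatMap-map≡cartesianProductWith cons (allFin (n fzero)) _))
    (cartesianProductWith⁺ (setoid (Fin (n fzero))) (tupleSetoid k (n ∘ fsuc)) (tupleSetoid (suc k) n)
       cons (λ cons≈cons → cons≈cons fzero , cons≈cons ∘ fsuc) (allFin⁺ (n fzero)) (allTuples-unique k (n ∘ fsuc)))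

sum-allTuples-suc : ∀ k (n : Fin (suc k) → ℕ) (g : Tuple (suc k) n → ℕ) →
  sum (map g (allTuples (suc k) n)) ≡
  sum (map (λ a → sum (map (λ f → g (cons a f)) (allTuples k (n ∘ fsuc)))) (allFin (n fzero)))
sum-allTuples-suc k n g = trans (sum-concatMap g _ (allFin (n fzero)))
  (sum-map-cong (λ a → sum-map-map g (cons a) (allTuples k (n ∘ fsuc))) (allFin (n fzero)))

prodFin-cong : ∀ k {f g : Fin k → ℕ} → (∀ i → f i ≡ g i) → prodFin k f ≡ prodFin k g
prodFin-cong zero    f≡g = refl
prodFin-cong (suc k) f≡g = cong₂ _*_ (f≡g fzero) (prodFin-cong k (f≡g ∘ fsuc))

N-cons : ∀ k (p m : Fin (suc k) → ℕ) c (j : Classes.Idx k (p ∘ fsuc) (m ∘ fsuc)) →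
  Classes.N (suc k) p m (cons c j) ≡ classSize (p fzero) (m fzero) (toℕ c) * Classes.N k (p ∘ fsuc) (m ∘ fsuc) j
N-cons k p m c j = cong₂ _*_ (factor≡classSize (suc k) p m _ _ (toℕ c)) (prodFin-cong k λ i →
  trans (factor≡classSize (suc k) p m _ _ (toℕ (j i))) (sym (factor≡classSize k (p ∘ fsuc) (m ∘ fsuc) _ _ (toℕ (j i)))))

cons-≃ : ∀ {k} {n : Fin (suc k) → ℕ} c {j j' : Tuple k (n ∘ fsuc)} → j ≃ j' → cons {n = n} c j ≃ cons c j'
cons-≃ c j≃j' fzero    = refl
cons-≃ c j≃j' (fsuc i) = j≃j' i

classTuple : ∀ k (p m : Fin k → ℕ) → Tuple k (λ i → p i ^ m i) → Tuple k (λ i → suc (m i))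
classTuple k p m x i = ClassOf.cls (p i) (m i) (x i)

-- Each class tuple j is the class of exactly N j tuples.
sum-classTuple : ∀ k (p m : Fin k → ℕ) → (∀ i → NonZero (p i)) →
  (H : Classes.Idx k p m → ℕ) → (∀ {j j'} → j ≃ j' → H j ≡ H j') →
  sum (map (H ∘ classTuple k p m) (allTuples k (λ i → p i ^ m i))) ≡
  sum (map (λ j → Classes.N k p m j * H j) (allTuples k (λ i → suc (m i))))
sum-classTuple zero    p m p≢0 H H-resp = cong (_+ 0) (trans (H-resp (λ ())) (sym (+-identityʳ _)))
sum-classTuple (suc k) p m p≢0 H H-resp = begin
  sum (map (H ∘ classTuple (suc k) p m) (allTuples (suc k) (λ i → p i ^ m i)))
    ≡⟨ sum-allTuples-suc k _ (H ∘ classTuple (suc k) p m) ⟩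
  sum (map (λ a → sum (map (λ f → H (classTuple (suc k) p m (cons a f))) xs')) as)
    ≡⟨ sum-map-cong (λ a → sum-map-cong (λ f → H-resp (cl-cons a f)) xs') as ⟩
  sum (map (λ a → sum (map (λ f → H (cons (cls₀ a) (classTuple k p' m' f))) xs')) as)
    ≡⟨ sum-map-cong (λ a → sum-classTuple k p' m' (p≢0 ∘ fsuc) (H ∘ cons (cls₀ a)) (H-resp ∘ cons-≃ (cls₀ a))) as ⟩
  sum (map (λ a → sum (map (λ j' → N' j' * H (cons (cls₀ a) j')) js')) as)
    ≡⟨ sum-swap (λ a j' → N' j' * H (cons (cls₀ a) j')) as js' ⟩
  sum (map (λ j' → sum (map (λ a → N' j' * H (cons (cls₀ a) j')) as)) js')
    ≡⟨ sum-map-cong (λ j' → ClassCount.sum-cls (p fzero) (m fzero) {{p≢0 fzero}} (λ c → N' j' * H (cons c j'))) js' ⟩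
  sum (map (λ j' → sum (map (λ c → factor₀ c * (N' j' * H (cons c j'))) cs)) js')
    ≡⟨ sym (sum-swap (λ c j' → factor₀ c * (N' j' * H (cons c j'))) cs js') ⟩
  sum (map (λ c → sum (map (λ j' → factor₀ c * (N' j' * H (cons c j'))) js')) cs)
    ≡⟨ sum-map-cong (λ c → sum-map-cong (λ j' → trans (sym (*-assoc (factor₀ c) (N' j') _)) (cong (_* H (cons c j')) (sym (N-cons k p m c j')))) js') cs ⟩
  sum (map (λ c → sum (map (λ j' → N (cons c j') * H (cons c j')) js')) cs)
    ≡⟨ sym (sum-allTuples-suc k _ (λ j → N j * H j)) ⟩
  sum (map (λ j → N j * H j) (allTuples (suc k) (λ i → suc (m i)))) ∎
  where
  open ≡-Reasoning
  p' = p ∘ fsuc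
  m' = m ∘ fsuc
  N  = Classes.N (suc k) p m
  N' = Classes.N k p' m'
  as  = allFin (p fzero ^ m fzero)
  cs  = allFin (suc (m fzero))
  xs' = allTuples k (λ i → p' i ^ m' i)
  js' = allTuples k (λ i → suc (m' i))
  cls₀ = ClassOf.cls (p fzero) (m fzero)
  factor₀ : Fin (suc (m fzero)) → ℕ
  factor₀ c = classSize (p fzero) (m fzero) (toℕ c)
  cl-cons : ∀ a f → classTuple (suc k) p m (cons a f) ≃ cons (cls₀ a) (classTuple k p' m' f)
  cl-cons a f fzero    = refl
  cl-cons a f (fsuc i) = refl

toℕ-mulMod : ∀ n .{{_ : NonZero n}} (a b : Fin n) → toℕ (mulMod n a b) ≡ (toℕ a * toℕ b) % n
toℕ-mulMod (suc n) a b = FP.toℕ-fromℕ< _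

IsOne⇒ : ∀ n .{{_ : NonZero n}} (a : Fin n) → IsOne n a → toℕ a ≡ 1 % n
IsOne⇒ (suc n) a a≡1 = trans (cong toℕ a≡1) (FP.toℕ-fromℕ< _)

⇒IsOne : ∀ n .{{_ : NonZero n}} (a : Fin n) → toℕ a ≡ 1 % n → IsOne n a
⇒IsOne (suc n) a a≡1 = FP.toℕ-injective (trans a≡1 (sym (FP.toℕ-fromℕ< _)))

module CozeroDivisorGraph (k : ℕ) (2≤k : 2 ≤ k) (p m : Fin k → ℕ)
                          (prime : ∀ i → Prime (p i)) (1≤m : ∀ i → 1 ≤ m i) where

  n : Fin k → ℕ
  n i = p i ^ m i

  open ProductRing k n
  open Classes k p m
  open ClassRelations k p m
  open ClassGraph k p m 1≤m 2≤k
  module Cᵢ (i : Fin k) = ClassOf (p i) (m i)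
  module Pᵢ (i : Fin k) = PrimePower (p i) (m i) (prime i) (1≤m i)

  instance
    nᵢ≢0 : ∀ {i} → NonZero (n i)
    nᵢ≢0 {i} = Pᵢ.pᵐ≢0 i

  cl : R → Idx
  cl = classTuple k p m

  toℕ-cl : ∀ x i → toℕ (cl x i) ≡ Cᵢ.class i (toℕ (x i))
  toℕ-cl x i = Cᵢ.toℕ-cls i (x i)

  ≈⇒≃ : ∀ {x y} → x ≈ y → cl x ≃ cl y
  ≈⇒≃ x≈y i = cong (toℕ ∘ Cᵢ.cls i) (x≈y i)

  ∈R⇒≼ : ∀ x y → x ∈R y → cl x ≼ cl y
  ∈R⇒≼ x y (r , x≈ry) i = subst₂ _⊑_ (sym (toℕ-cl x i)) (sym (toℕ-cl y i))
    (Pᵢ.∈⇒⊑ i (toℕ (x i)) (toℕ (y i)) (toℕ (r i)) (FP.toℕ<n (x i))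
       (trans (cong toℕ (x≈ry i)) (toℕ-mulMod (n i) (r i) (y i))))

  ≼⇒∈R : ∀ x y → cl x ≼ cl y → x ∈R y
  ≼⇒∈R x y x≼y = r , λ i → FP.toℕ-injective (begin
    toℕ (x i)                        ≡⟨ proj₂ (proj₂ (witness i)) ⟩
    (proj₁ (witness i) * toℕ (y i)) % n i ≡⟨ cong (λ z → (z * toℕ (y i)) % n i) (sym (FP.toℕ-fromℕ< (proj₁ (proj₂ (witness i))))) ⟩
    (toℕ (r i) * toℕ (y i)) % n i    ≡⟨ sym (toℕ-mulMod (n i) (r i) (y i)) ⟩
    toℕ (mulMod (n i) (r i) (y i))   ∎)
    where
    open ≡-Reasoning
    witness : ∀ i → ∃[ r ] r < n i × toℕ (x i) ≡ (r * toℕ (y i)) % n i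
    witness i = Pᵢ.⊑⇒∈ i (toℕ (x i)) (toℕ (y i)) (FP.toℕ<n (x i)) (FP.toℕ<n (y i))
                  (subst₂ _⊑_ (toℕ-cl x i) (toℕ-cl y i) (x≼y i))
    r : R
    r i = fromℕ< (proj₁ (proj₂ (witness i)))

  IsZero⇒AllZero : ∀ x → IsZero x → AllZero (cl x)
  IsZero⇒AllZero x x≡0 i = trans (toℕ-cl x i) (cong (Cᵢ.class i) (x≡0 i))

  AllZero⇒IsZero : ∀ x → AllZero (cl x) → IsZero x
  AllZero⇒IsZero x cl≡0 i = class≡0 (toℕ (x i)) (trans (sym (toℕ-cl x i)) (cl≡0 i))
    where
    class≡0 : ∀ a → Cᵢ.class i a ≡ 0 → a ≡ 0
    class≡0 zero _ = refl

  IsUnit⇒AllOne : ∀ x → IsUnit x → AllOne (cl x)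
  IsUnit⇒AllOne x (u , xu≡1) i = trans (toℕ-cl x i) (Pᵢ.unit⇒class≡1 i (toℕ (x i)) (toℕ (u i))
    (trans (sym (toℕ-mulMod (n i) (x i) (u i))) (IsOne⇒ (n i) _ (xu≡1 i))))

  AllOne⇒IsUnit : ∀ x → AllOne (cl x) → IsUnit x
  AllOne⇒IsUnit x cl≡1 = u , λ i → ⇒IsOne (n i) _ (begin
    toℕ (mulMod (n i) (x i) (u i))      ≡⟨ toℕ-mulMod (n i) (x i) (u i) ⟩
    (toℕ (x i) * toℕ (u i)) % n i       ≡⟨ cong (λ z → (toℕ (x i) * z) % n i) (FP.toℕ-fromℕ< (proj₁ (proj₂ (witness i)))) ⟩
    (toℕ (x i) * proj₁ (witness i)) % n i ≡⟨ proj₂ (proj₂ (witness i)) ⟩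
    1 % n i                             ∎)
    where
    open ≡-Reasoning
    witness : ∀ i → ∃[ r ] r < n i × (toℕ (x i) * r) % n i ≡ 1 % n i
    witness i = Pᵢ.class≡1⇒unit i (toℕ (x i)) (FP.toℕ<n (x i)) (trans (sym (toℕ-cl x i)) (cl≡1 i))
    u : R
    u i = fromℕ< (proj₁ (proj₂ (witness i)))

  IsVertex⇒InJ : ∀ x → IsVertex x → InJ (cl x)
  IsVertex⇒InJ x (x≢0 , x∤1) = x≢0 ∘ AllZero⇒IsZero x , x∤1 ∘ AllOne⇒IsUnit x

  InJ⇒IsVertex : ∀ x → InJ (cl x) → IsVertex x
  InJ⇒IsVertex x (cl≢0 , cl≢1) = cl≢0 ∘ IsZero⇒AllZero x , cl≢1 ∘ IsUnit⇒AllOne x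

  Adj⇒ClassAdj : ∀ x y → Adj x y → ClassAdj (cl x) (cl y)
  Adj⇒ClassAdj x y (x∉Ry , y∉Rx) = x∉Ry ∘ ≼⇒∈R x y , y∉Rx ∘ ≼⇒∈R y x

  ClassAdj⇒Adj : ∀ x y → ClassAdj (cl x) (cl y) → Adj x y
  ClassAdj⇒Adj x y (x⋠y , y⋠x) = x⋠y ∘ ∈R⇒≼ x y , y⋠x ∘ ∈R⇒≼ y x

  rep : Idx → R
  rep w i = fromℕ< (Pᵢ.rep< i (toℕ (w i)) (FP.toℕ<n (w i)))

  cl-rep : ∀ w → cl (rep w) ≃ w
  cl-rep w i = begin
    toℕ (cl (rep w) i)                            ≡⟨ toℕ-cl (rep w) i ⟩
    Cᵢ.class i (toℕ (rep w i))                    ≡⟨ cong (Cᵢ.class i) (FP.toℕ-fromℕ< _) ⟩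
    Cᵢ.class i (Pᵢ.rep i (toℕ (w i)))             ≡⟨ Pᵢ.class-rep i (toℕ (w i)) (FP.toℕ<n (w i)) ⟩
    toℕ (w i)                                     ∎
    where open ≡-Reasoning

  InJ⇒IsVertex-rep : ∀ w → InJ w → IsVertex (rep w)
  InJ⇒IsVertex-rep w Jw = InJ⇒IsVertex (rep w) (InJ-resp (≃-sym (cl-rep w)) Jw)

  classDist : Idx → Idx → ℕ
  classDist j l = ind (classAdj? j l) 1 + 2 * ind (¬? (classAdj? j l) ×-dec ¬? (inS? j l)) 1
                + 3 * ind (inS? j l) 1

  classDist≡1 : ∀ {j l} → ClassAdj j l → classDist j l ≡ 1
  classDist≡1 {j} {l} j~l = cong₂ _+_
    (cong₂ _+_ (ind-yes (classAdj? j l) j~l)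
               (cong (2 *_) (ind-no (¬? (classAdj? j l) ×-dec ¬? (inS? j l)) (λ (¬j~l , _) → ¬j~l j~l))))
    (cong (3 *_) (ind-no (inS? j l) (λ s → InS⇒¬ClassAdj s j~l)))

  classDist≡2 : ∀ {j l} → ¬ ClassAdj j l → ¬ InS j l → classDist j l ≡ 2
  classDist≡2 {j} {l} ¬j~l ¬s = cong₂ _+_
    (cong₂ _+_ (ind-no (classAdj? j l) ¬j~l)
               (cong (2 *_) (ind-yes (¬? (classAdj? j l) ×-dec ¬? (inS? j l)) (¬j~l , ¬s))))
    (cong (3 *_) (ind-no (inS? j l) ¬s))

  classDist≡3 : ∀ {j l} → InS j l → classDist j l ≡ 3
  classDist≡3 {j} {l} s = cong₂ _+_
    (cong₂ _+_ (ind-no (classAdj? j l) (InS⇒¬ClassAdj s))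
               (cong (2 *_) (ind-no (¬? (classAdj? j l) ×-dec ¬? (inS? j l)) (λ (_ , ¬s) → ¬s s))))
    (cong (3 *_) (ind-yes (inS? j l) s))

  classDist-cong : ∀ {j l j' l'} →
    (ClassAdj j l → ClassAdj j' l') → (ClassAdj j' l' → ClassAdj j l) →
    (InS j l → InS j' l') → (InS j' l' → InS j l) → classDist j l ≡ classDist j' l'
  classDist-cong {j} {l} {j'} {l'} adj⇒ ⇐adj s⇒ ⇐s = cong₂ _+_
    (cong₂ _+_ (ind-⇔ adj⇒ ⇐adj (classAdj? j l) (classAdj? j' l'))
               (cong (2 *_) (ind-⇔ (λ (¬a , ¬s) → ¬a ∘ ⇐adj , ¬s ∘ ⇐s) (λ (¬a , ¬s) → ¬a ∘ adj⇒ , ¬s ∘ s⇒)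
                                   (¬? (classAdj? j l) ×-dec ¬? (inS? j l))
                                   (¬? (classAdj? j' l') ×-dec ¬? (inS? j' l')))))
    (cong (3 *_) (ind-⇔ s⇒ ⇐s (inS? j l) (inS? j' l')))

  classDist-resp : ∀ {j j' l l'} → j ≃ j' → l ≃ l' → classDist j l ≡ classDist j' l'
  classDist-resp j≃j' l≃l' = classDist-cong
    (ClassAdj-resp j≃j' l≃l') (ClassAdj-resp (≃-sym j≃j') (≃-sym l≃l'))
    (InS-resp j≃j' l≃l') (InS-resp (≃-sym j≃j') (≃-sym l≃l'))

  classDist-sym : ∀ j l → classDist j l ≡ classDist l j
  classDist-sym j l = classDist-cong ClassAdj-sym ClassAdj-sym InS-sym InS-sym

  classDist-refl : ∀ j → classDist j j ≡ 2
  classDist-refl j = classDist≡2 (ClassAdj-irrefl j) (¬InS-refl j)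

  dist : R → R → ℕ
  dist x y = classDist (cl x) (cl y)

  ≃-refl : ∀ {j : Idx} → j ≃ j
  ≃-refl _ = refl

  walk-end : ∀ {x y j} → cl x ≃ j → ClassAdj j (cl y) → IsVertex y → Walk x y 1
  walk-end {x} {y} x≃j j~y vy = step vy (ClassAdj⇒Adj x y (ClassAdj-resp (≃-sym x≃j) ≃-refl j~y)) (here λ _ → refl)

  walk-step : ∀ {x y j l} w → cl x ≃ j → ClassAdj j w → InJ w → Walk (rep w) y l → Walk x y (suc l)
  walk-step {x} w x≃j j~w Jw =
    step (InJ⇒IsVertex-rep w Jw) (ClassAdj⇒Adj x (rep w) (ClassAdj-resp (≃-sym x≃j) (≃-sym (cl-rep w)) j~w))

  CommonNeighbour⇒Walk₂ : ∀ {x y} → IsVertex y → CommonNeighbour (cl x) (cl y) → Walk x y 2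
  CommonNeighbour⇒Walk₂ vy (z , Jz , x~z , z~y) = walk-step z ≃-refl x~z Jz (walk-end (cl-rep z) z~y vy)

  Path₃⇒Walk₃ : ∀ {x y} → IsVertex y → Path₃ (cl x) (cl y) → Walk x y 3
  Path₃⇒Walk₃ vy (z₁ , J₁ , x~z₁ , z₂ , J₂ , z₁~z₂ , z₂~y) =
    walk-step z₁ ≃-refl x~z₁ J₁ (walk-step z₂ (cl-rep z₁) z₁~z₂ J₂ (walk-end (cl-rep z₂) z₂~y vy))

  ¬Walk₀ : ∀ {x y} → ¬ x ≈ y → ¬ Walk x y 0
  ¬Walk₀ x≉y (here x≈y) = x≉y x≈y

  Walk₁⇒ClassAdj : ∀ {x y} → Walk x y 1 → ClassAdj (cl x) (cl y)
  Walk₁⇒ClassAdj {x} (step {z = z} _ x~z (here z≈y)) = ClassAdj-resp ≃-refl (≈⇒≃ z≈y) (Adj⇒ClassAdj x z x~z)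

  Walk₂⇒CommonNeighbour : ∀ {x y} → Walk x y 2 → CommonNeighbour (cl x) (cl y)
  Walk₂⇒CommonNeighbour {x} (step {z = z} vz x~z w) =
    cl z , IsVertex⇒InJ z vz , Adj⇒ClassAdj x z x~z , Walk₁⇒ClassAdj w

  shortest : ∀ {x y d} → Walk x y d → (∀ {l} → l < d → ¬ Walk x y l) → IsDistance x y d
  shortest w no-shorter = w , λ l w' → ≮⇒≥ (λ l<d → no-shorter l<d w')

  dist-correct : ∀ {x y} → IsVertex x → IsVertex y → ¬ x ≈ y → IsDistance x y (dist x y)
  dist-correct {x} {y} vx vy x≉y with classAdj? (cl x) (cl y) | inS? (cl x) (cl y)
  ... | yes x~y | _ = subst (IsDistance x y) (sym (classDist≡1 x~y)) (shortest (walk-end ≃-refl x~y vy) no-shorter)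
    where
    no-shorter : ∀ {l} → l < 1 → ¬ Walk x y l
    no-shorter {zero} _ = ¬Walk₀ x≉y
    no-shorter {suc _} (s≤s ())
  ... | no ¬x~y | yes s = subst (IsDistance x y) (sym (classDist≡3 s)) (shortest (Path₃⇒Walk₃ vy (InS⇒Path₃ s)) no-shorter)
    where
    no-shorter : ∀ {l} → l < 3 → ¬ Walk x y l
    no-shorter {0} _ = ¬Walk₀ x≉y
    no-shorter {1} _ = ¬x~y ∘ Walk₁⇒ClassAdj
    no-shorter {2} _ = InS⇒¬CommonNeighbour s ∘ Walk₂⇒CommonNeighbour
    no-shorter {suc (suc (suc _))} (s≤s (s≤s (s≤s ())))
  ... | no ¬x~y | no ¬s = subst (IsDistance x y) (sym (classDist≡2 ¬x~y ¬s)) (shortest (CommonNeighbour⇒Walk₂ vy common) no-shorter)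
    where
    common = ¬InS⇒CommonNeighbour (IsVertex⇒InJ x vx) (IsVertex⇒InJ y vy) ¬x~y ¬s
    no-shorter : ∀ {l} → l < 2 → ¬ Walk x y l
    no-shorter {0} _ = ¬Walk₀ x≉y
    no-shorter {1} _ = ¬x~y ∘ Walk₁⇒ClassAdj
    no-shorter {suc (suc _)} (s≤s (s≤s ()))

AllPairs-All : ∀ {A : Set} {P : A → Set} {R : A → A → Set} {xs} →
               All P xs → AllPairs R xs → AllPairs (λ x y → P x × P y × R x y) xs
AllPairs-All []         []         = []
AllPairs-All (px ∷ pxs) (rx ∷ rxs) = All.zipWith (λ (py , r) → px , py , r) (pxs , rx) ∷ AllPairs-All pxs rxs

module WienerIndex (k : ℕ) (2≤k : 2 ≤ k) (p m : Fin k → ℕ)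
                   (prime : ∀ i → Prime (p i)) (1≤m : ∀ i → 1 ≤ m i) where
  open CozeroDivisorGraph k 2≤k p m prime 1≤m
  open ProductRing k n
  open Classes k p m
  open ClassRelations k p m

  distances-correct : AllPairs (λ x y → IsDistance x y (dist x y)) vertices
  distances-correct = AllPairs.map (λ (vx , vy , x≉y) → dist-correct vx vy x≉y)
    (AllPairs-All (all-filter isVertex? (allTuples k n))
                  (filter⁺ (tupleSetoid k n) isVertex? (allTuples-unique k n)))

  sum-vertices : ∀ (Φ : Idx → ℕ) → (∀ {j j'} → j ≃ j' → Φ j ≡ Φ j') →
                 sum (map (Φ ∘ cl) vertices) ≡ sum (map (λ j → N j * Φ j) J)
  sum-vertices Φ Φ-resp = begin
    sum (map (Φ ∘ cl) (filter isVertex? (allTuples k n)))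
      ≡⟨ sum-map-filter isVertex? (Φ ∘ cl) (allTuples k n) ⟩
    sum (map (λ x → ind (isVertex? x) (Φ (cl x))) (allTuples k n))
      ≡⟨ sum-map-cong (λ x → ind-⇔ (IsVertex⇒InJ x) (InJ⇒IsVertex x) (isVertex? x) (inJ? (cl x))) (allTuples k n) ⟩
    sum (map (λ x → ind (inJ? (cl x)) (Φ (cl x))) (allTuples k n))
      ≡⟨ sum-classTuple k p m (λ i → Pᵢ.p≢0 i) (λ j → ind (inJ? j) (Φ j)) H-resp ⟩
    sum (map (λ j → N j * ind (inJ? j) (Φ j)) (allTuples k (λ i → suc (m i))))
      ≡⟨ sum-map-cong (λ j → *-ind (inJ? j) (N j) (Φ j)) (allTuples k (λ i → suc (m i))) ⟩
    sum (map (λ j → ind (inJ? j) (N j * Φ j)) (allTuples k (λ i → suc (m i))))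
      ≡⟨ sym (sum-map-filter inJ? (λ j → N j * Φ j) (allTuples k (λ i → suc (m i)))) ⟩
    sum (map (λ j → N j * Φ j) J) ∎
    where
    open ≡-Reasoning
    H-resp : ∀ {j j'} → j ≃ j' → ind (inJ? j) (Φ j) ≡ ind (inJ? j') (Φ j')
    H-resp {j} {j'} j≃j' =
      trans (ind-⇔ (InJ-resp j≃j') (InJ-resp (≃-sym j≃j')) (inJ? j) (inJ? j')) (cong (ind (inJ? j')) (Φ-resp j≃j'))

  F : Idx → Idx → ℕ
  F j l = N j * (N l * classDist j l)

  F-sym : ∀ j l → F j l ≡ F l j
  F-sym j l = trans (cong (λ d → N j * (N l * d)) (classDist-sym j l))
                    (solve 3 (λ a b d → a :* (b :* d) := b :* (a :* d)) refl (N j) (N l) (classDist l j))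

  double-sum : sum (map (λ x → sum (map (dist x) vertices)) vertices) ≡ sum (map (λ j → sum (map (F j) J)) J)
  double-sum = begin
    sum (map (λ x → sum (map (dist x) vertices)) vertices)
      ≡⟨ sum-map-cong (λ x → sum-vertices (classDist (cl x)) (classDist-resp ≃-refl)) vertices ⟩
    sum (map (λ x → sum (map (λ l → N l * classDist (cl x) l) J)) vertices)
      ≡⟨ sum-vertices (λ j → sum (map (λ l → N l * classDist j l) J))
                      (λ j≃j' → sum-map-cong (λ l → cong (N l *_) (classDist-resp j≃j' ≃-refl)) J) ⟩
    sum (map (λ j → N j * sum (map (λ l → N l * classDist j l) J)) J)
      ≡⟨ sum-map-cong (λ j → sym (sum-map-*ˡ (N j) (λ l → N l * classDist j l) J)) J ⟩
    sum (map (λ j → sum (map (F j) J)) J) ∎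
    where open ≡-Reasoning

  pairSum-F : pairSum F J ≡
    pairSum (λ j l → ind (classAdj? j l) (N j * N l)) J
    + 2 * pairSum (λ j l → ind (¬? (classAdj? j l) ×-dec ¬? (inS? j l)) (N j * N l)) J
    + 3 * pairSum (λ j l → ind (inS? j l) (N j * N l)) J
  pairSum-F = begin
    pairSum F J                                 ≡⟨ pairSum-cong split J ⟩
    pairSum (λ j l → (adj j l + 2 * far j l) + 3 * S j l) J
      ≡⟨ pairSum-+ (λ j l → adj j l + 2 * far j l) (λ j l → 3 * S j l) J ⟩
    pairSum (λ j l → adj j l + 2 * far j l) J + pairSum (λ j l → 3 * S j l) J
      ≡⟨ cong₂ _+_ (trans (pairSum-+ adj (λ j l → 2 * far j l) J) (cong (pairSum adj J +_) (pairSum-*ˡ 2 far J)))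
                   (pairSum-*ˡ 3 S J) ⟩
    pairSum adj J + 2 * pairSum far J + 3 * pairSum S J ∎
    where
    open ≡-Reasoning
    adj far S : Idx → Idx → ℕ
    adj j l = ind (classAdj? j l) (N j * N l)
    far j l = ind (¬? (classAdj? j l) ×-dec ¬? (inS? j l)) (N j * N l)
    S   j l = ind (inS? j l) (N j * N l)
    split : ∀ j l → F j l ≡ (adj j l + 2 * far j l) + 3 * S j l
    split j l rewrite ind≡ind1* (classAdj? j l) (N j * N l)
                    | ind≡ind1* (¬? (classAdj? j l) ×-dec ¬? (inS? j l)) (N j * N l)
                    | ind≡ind1* (inS? j l) (N j * N l) =
      solve 5 (λ a b x y z → a :* (b :* (x :+ con 2 :* y :+ con 3 :* z))
                          := x :* (a :* b) :+ con 2 :* (y :* (a :* b)) :+ con 3 :* (z :* (a :* b)))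
            refl (N j) (N l) (ind (classAdj? j l) 1) (ind (¬? (classAdj? j l) ×-dec ¬? (inS? j l)) 1) (ind (inS? j l) 1)

  D : ℕ
  D = sum (map (λ j → N j * 2) J)

  diagonal : sum (map (λ x → dist x x) vertices) ≡ D
  diagonal = trans (sum-map-cong (classDist-refl ∘ cl) vertices) (sum-vertices (λ _ → 2) (λ _ → refl))

  diagonal-F : sum (map (λ j → F j j) J) ≡ 4 * sum (map (λ j → N j C 2) J) + D
  diagonal-F = begin
    sum (map (λ j → F j j) J)                           ≡⟨ sum-map-cong pointwise J ⟩
    sum (map (λ j → 4 * (N j C 2) + N j * 2) J)         ≡⟨ sum-map-+ (λ j → 4 * (N j C 2)) (λ j → N j * 2) J ⟩
    sum (map (λ j → 4 * (N j C 2)) J) + D               ≡⟨ cong (_+ D) (sum-map-*ˡ 4 (λ j → N j C 2) J) ⟩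
    4 * sum (map (λ j → N j C 2) J) + D                 ∎
    where
    open ≡-Reasoning
    pointwise : ∀ j → F j j ≡ 4 * (N j C 2) + N j * 2
    pointwise j = begin
      N j * (N j * classDist j j)   ≡⟨ cong (λ d → N j * (N j * d)) (classDist-refl j) ⟩
      N j * (N j * 2)               ≡⟨ solve 1 (λ x → x :* (x :* con 2) := con 2 :* (x :* x)) refl (N j) ⟩
      2 * (N j * N j)               ≡⟨ cong (2 *_) (sym (2*nC2+n≡n*n (N j))) ⟩
      2 * (2 * (N j C 2) + N j)     ≡⟨ solve 2 (λ c x → con 2 :* (con 2 :* c :+ x) := con 4 :* c :+ x :* con 2) refl (N j C 2) (N j) ⟩
      4 * (N j C 2) + N j * 2       ∎

  wiener : pairSum dist vertices ≡ RHS
  wiener = *-cancelˡ-≡ (pairSum dist vertices) RHS 2 (+-cancelʳ-≡ D _ _ (begin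
    2 * pairSum dist vertices + D
      ≡⟨ cong (2 * pairSum dist vertices +_) (sym diagonal) ⟩
    2 * pairSum dist vertices + sum (map (λ x → dist x x) vertices)
      ≡⟨ pairSum-symmetric dist (λ x y → classDist-sym (cl x) (cl y)) vertices ⟩
    sum (map (λ x → sum (map (dist x) vertices)) vertices)
      ≡⟨ double-sum ⟩
    sum (map (λ j → sum (map (F j) J)) J)
      ≡⟨ sym (pairSum-symmetric F F-sym J) ⟩
    2 * pairSum F J + sum (map (λ j → F j j) J)
      ≡⟨ cong₂ (λ a b → 2 * a + b) pairSum-F diagonal-F ⟩
    2 * (Pa + 2 * Pb + 3 * Pc) + (4 * SC + D)
      ≡⟨ solve 5 (λ a b c s d → con 2 :* (a :+ con 2 :* b :+ con 3 :* c) :+ (con 4 :* s :+ d)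
                              := con 2 :* (con 2 :* s :+ a :+ con 2 :* b :+ con 3 :* c) :+ d) refl Pa Pb Pc SC D ⟩
    2 * RHS + D ∎))
    where
    open ≡-Reasoning
    Pa = pairSum (λ j l → ind (classAdj? j l) (N j * N l)) J
    Pb = pairSum (λ j l → ind (¬? (classAdj? j l) ×-dec ¬? (inS? j l)) (N j * N l)) J
    Pc = pairSum (λ j l → ind (inS? j l) (N j * N l)) J
    SC = sum (map (λ j → N j C 2) J)

theorem3p2 : (k : ℕ) → 2 ≤ k → (p m : Fin k → ℕ) → (∀ i → Prime (p i)) → (∀ i → 1 ≤ m i) →
    WienerIndexIs k (λ i → p i ^ m i) (Classes.RHS k p m)
theorem3p2 k 2≤k p m prime 1≤m = dist , distances-correct , wiener
  where
  open CozeroDivisorGraph k 2≤k p m prime 1≤m using (dist)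
  open WienerIndex k 2≤k p m prime 1≤m
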